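{- Let $\lambda\vdash n$ have exactly $k$ parts and let $r=\lambda_k$. Let $\mu\vdash n$ have at most $k$ parts (write $\mu_k=0$ if $\mu$ has fewer than $k$ parts). Then: (1) if $\mu_k<\lambda_k$, then $\mathcal{D}(\mathbb{J}_\lambda,J_\mu)=\emptyset$, so $A(\lambda,\mu)=0$; (2) if $\mu_k\ge\lambda_k$, then for every integer $\ell$ with $0\le\ell\le r$ there is a bijection between $\mathcal{D}(\mathbb{J}_\lambda,J_\mu)$ and $\mathcal{D}(\mathbb{J}_{\lambda[\ell]},J_{\mu[\ell]})$ (the latter a subset of $\mathfrak{S}_{n-k\ell}$), and in particular $A(\lambda,\mu)=A(\lambda[\ell],\mu[\ell])$.
   Context: For $m\ge1$, let $\Delta_m=\{\alpha_1,\dots,\alpha_{m-1}\}$ be the simple roots of $\mathfrak{gl}(m,\mathbb{C})$ ($\alpha_j=t_j-t_{j+1}$). For $w\in\mathfrak{S}_m$: $\mathrm{Des}_L(w)=\{\alpha_j:w^{ -1}(j)>w^{ -1}(j+1)\}$, $\mathrm{Des}_R(w)=\{\alpha_j:w(j)>w(j+1)\}$. For $J,K\subseteq\Delta_m$, $\mathcal{D}(J,K)=\{w\in\mathfrak{S}_m:\mathrm{Des}_L(w)=\Delta_m\setminus J,\ \mathrm{Des}_R(w)\subseteq\Delta_m\setminus K\}$. For $\mu=(\mu_1,\dots,\mu_p)\vdash m$ with $p$ parts, $J_\mu=\Delta_m\setminus\{\alpha_{\mu_1},\alpha_{\mu_1+\mu_2},\dots,\alpha_{\mu_1+\cdots+\mu_{p-1}}\}$;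 $\mathbb{J}_\lambda=\Delta_m\setminus J_{\lambda^\vee}$ where $\lambda^\vee$ is the dual partition; and $A(\lambda,\mu)=|\mathcal{D}(\mathbb{J}_\lambda,J_\mu)|$ for $\lambda,\mu\vdash m$. For a partition $\nu$ and integer $\ell\ge0$, $\nu[\ell]$ is the partition obtained by deleting the leftmost $\ell$ columns of the Young diagram of $\nu$. -}

module Defs where

open import Data.Bool using (Bool; true; false; not; _∧_; _∨_; T; if_then_else_)
open import Data.Nat using (ℕ; zero; suc; _+_; _∸_; _≤_; _<ᵇ_; _≤ᵇ_; _≡ᵇ_)
open import Data.Fin using (Fin; toℕ)
open import Data.Fin using (_≟_)
open import Data.List using (List; []; _∷_; map; length; filterᵇ; concatMap; upTo; allFin)
open import Data.Nat.ListAction using (sum)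
open import Data.Bool.ListAction using (all; any)
open import Data.Vec using (Vec; toList) renaming ([] to []ᵛ; _∷_ to _∷ᵛ_)
open import Data.Product using (Σ; _×_)
open import Relation.Binary.PropositionalEquality using (_≡_)
open import Relation.Nullary.Decidable using (⌊_⌋)

data Decreasing : List ℕ → Set where
  dec-[]  : Decreasing []
  dec-[x] : ∀ {x} → Decreasing (x ∷ [])
  dec-∷   : ∀ {x y ys} → y ≤ x → Decreasing (y ∷ ys) → Decreasing (x ∷ y ∷ ys)

IsPartition : ℕ → List ℕ → Set
IsPartition n ν = Decreasing ν × T (all (λ x → 1 ≤ᵇ x) ν) × sum ν ≡ n

-- i-th part (1-based), 0 if ν has fewer than i parts (convention μ_k = 0)
part : List ℕ → ℕ → ℕ
part []      _             = 0
part (x ∷ _) 0             = 0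
part (x ∷ _) 1             = x
part (_ ∷ xs) (suc (suc i)) = part xs (suc i)

dual : List ℕ → List ℕ
dual []       = []
dual (x ∷ xs) = map (λ i → length (filterᵇ (λ y → suc i ≤ᵇ y) (x ∷ xs))) (upTo x)

-- ν[ℓ]: delete the leftmost ℓ columns of the Young diagram
cut : ℕ → List ℕ → List ℕ
cut ℓ ν = filterᵇ (λ x → 1 ≤ᵇ x) (map (λ x → x ∸ ℓ) ν)

-- Subsets of Δ_m = {α₁,…,α_{m-1}} are encoded as Boolean predicates on the
-- index j (α_j ↔ j); only values 1 ≤ j ≤ m-1 are ever consulted.

Roots : Set
Roots = ℕ → Bool

properPartialSums : List ℕ → List ℕ
properPartialSums []           = []
properPartialSums (x ∷ [])     = []
properPartialSums (x ∷ y ∷ ys) = x ∷ map (x +_) (properPartialSums (y ∷ ys))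

_∈ᵇ_ : ℕ → List ℕ → Bool
j ∈ᵇ xs = any (λ x → j ≡ᵇ x) xs

Jpart : List ℕ → Roots
Jpart μ j = not (j ∈ᵇ properPartialSums μ)

𝕁 : List ℕ → Roots
𝕁 λ' j = not (Jpart (dual λ') j)

-- Permutations of {1,…,m} in one-line notation: w = (w(1),…,w(m)),
-- stored as a vector of Fin m (value v : Fin m stands for toℕ v + 1).

Word : ℕ → Set
Word m = Vec (Fin m) m

values : ∀ {m} → Word m → List ℕ
values w = map (λ v → suc (toℕ v)) (toList w)

-- injective (hence bijective) words
distinctᵇ : ∀ {m} → List (Fin m) → Bool
distinctᵇ []       = true
distinctᵇ (x ∷ xs) = not (any (λ y → ⌊ x ≟ y ⌋) xs) ∧ distinctᵇ xs

isPermᵇ : ∀ {m} → Word m → Bool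
isPermᵇ w = distinctᵇ (toList w)

-- 1-based lookup w(i), default 0
nth : List ℕ → ℕ → ℕ
nth []       _             = 0
nth (x ∷ _)  0             = 0
nth (x ∷ _)  1             = x
nth (_ ∷ xs) (suc (suc i)) = nth xs (suc i)

-- 1-based position of value v, i.e. w⁻¹(v) (default 0)
pos : List ℕ → ℕ → ℕ
pos []       v = 0
pos (x ∷ xs) v = if v ≡ᵇ x then 1 else (if 0 <ᵇ pos xs v then suc (pos xs v) else 0)

desRᵇ : ∀ {m} → Word m → ℕ → Bool
desRᵇ w j = nth (values w) (suc j) <ᵇ nth (values w) j

desLᵇ : ∀ {m} → Word m → ℕ → Bool
desLᵇ w j = pos (values w) (suc j) <ᵇ pos (values w) j

_⇔ᵇ_ : Bool → Bool → Bool
true  ⇔ᵇ b = b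
false ⇔ᵇ b = not b

_⇒ᵇ_ : Bool → Bool → Bool
a ⇒ᵇ b = not a ∨ b

simpleIdx : ℕ → List ℕ
simpleIdx m = map suc (upTo (m ∸ 1))

descCondᵇ : ∀ m → Roots → Roots → Word m → Bool
descCondᵇ m J K w =
  all (λ j → (desLᵇ w j ⇔ᵇ not (J j)) ∧ (desRᵇ w j ⇒ᵇ not (K j))) (simpleIdx m)

𝒟 : (m : ℕ) → Roots → Roots → Set
𝒟 m J K = Σ (Word m) (λ w → T (isPermᵇ w) × T (descCondᵇ m J K w))

allVecs : (m k : ℕ) → List (Vec (Fin m) k)
allVecs m zero    = []ᵛ ∷ []
allVecs m (suc k) = concatMap (λ x → map (x ∷ᵛ_) (allVecs m k)) (allFin m)

card𝒟 : (m : ℕ) → Roots → Roots → ℕ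
card𝒟 m J K = length (filterᵇ (λ w → isPermᵇ w ∧ descCondᵇ m J K w) (allVecs m m))

A : ℕ → List ℕ → List ℕ → ℕ
A m λ' μ = card𝒟 m (𝕁 λ') (Jpart μ)

module Submission where

-- Encode w ∈ 𝔖_n by its one-line list of values.  Des_L(w) = Δ ∖ 𝕁_λ
-- contains α₁,…,α_{k-1} (the first column of λ has k boxes), so the values
-- 1,…,k occur in w in the order k, k-1, …, 1 (the countdown).  Des_R(w) ⊆ Δ ∖ J_μ
-- says w increases on each of the consecutive μ-blocks, so every block holds
-- at most one of 1,…,k: with fewer than k blocks there is no such w, and with
-- exactly k blocks the i-th block starts with k+1-i.  Deleting 1,…,k and
-- lowering the other values by k ("peeling") is then a bijection onto
-- 𝒟(𝕁_{λ[1]}, J_{μ[1]}) ⊆ 𝔖_{n-k}; its inverse reattaches the countdown as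
-- block heads.  Peeling t columns iterates this while t ≤ min(λ_k, μ_k), which
-- gives (2); for (1), peel μ_k columns so that μ loses a row but λ does not.

open import Defs
open import Data.Bool using (Bool; true; false; not; _∧_; _∨_; T; if_then_else_)
open import Data.Bool.Properties using (T?; not-involutive; T-irrelevant)
open import Data.Bool.ListAction using (all; any)
open import Data.Empty using (⊥; ⊥-elim)
open import Data.Fin using (Fin; toℕ; fromℕ<) renaming (_≟_ to _≟ᶠ_)
open import Data.Fin.Properties using (toℕ-injective; toℕ<n; toℕ-fromℕ<)
open import Data.List using (List; []; _∷_; _++_; map; length; filterᵇ; concat; concatMap; take; drop; zipWith; applyUpTo; allFin)
open import Data.List.Properties using (length-map; length-++; length-++-≤ˡ; ++-identityʳ; map-++; take++drop≡id; length-take; length-drop; ∷-injectiveˡ; ∷-injectiveʳ; map-injective; filter-++; filter-notAll; length-filter)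
open import Data.List.Membership.Propositional using (_∈_; _∉_)
open import Data.List.Membership.Propositional.Properties using (∈-filter⁺; ∈-filter⁻; ∈-map⁺; ∈-map⁻; ∈-++⁺ˡ; ∈-++⁺ʳ; ∈-++⁻; ∈-concat⁺′; ∈-allFin)
open import Data.List.Relation.Unary.Any using (here; there)
import Data.List.Relation.Unary.Any as Any
open import Data.List.Relation.Unary.Any.Properties using (any⁺; any⁻)
open import Data.List.Relation.Unary.AllPairs using () renaming (_∷_ to _∷ᵖ_)
open import Data.List.Relation.Unary.Unique.Propositional using (Unique)
open import Data.List.Relation.Unary.Unique.Propositional.Properties using (allFin⁺; Unique[x∷xs]⇒x∉xs)
import Data.Nat as ℕ
open import Data.Nat using (ℕ; zero; suc; _+_; _∸_; _*_; _≤_; _<_; z≤n; s≤s; _<ᵇ_; _≤ᵇ_; _≡ᵇ_)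
open import Data.Nat.Properties
open import Data.Nat.ListAction using (sum)
open import Data.Nat.Solver using (module +-*-Solver)
open +-*-Solver using (solve; _:+_; _:=_)
open import Data.List.Membership.DecPropositional ℕ._≟_ using (_∈?_)
open import Data.Product using (Σ; _×_; _,_; proj₁; proj₂; ∃)
open import Data.Sum using (_⊎_; inj₁; inj₂; [_,_]′)
open import Data.Unit using (tt)
open import Data.Vec using (Vec; toList; head) renaming ([] to []ᵛ; _∷_ to _∷ᵛ_)
open import Data.Vec.Properties using (length-toList; ≡-dec) renaming (∷-injectiveʳ to ∷ᵛ-injectiveʳ)
open import Function using (_∘_; case_of_)
open import Function.Bundles using (_⤖_; mk⤖; Bijection)
open import Function.Construct.Composition using (_⤖-∘_)
open import Function.Construct.Identity using (⤖-id)
open import Relation.Binary.Definitions using (DecidableEquality; tri<; tri≈; tri>)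
open import Relation.Binary.PropositionalEquality
open import Relation.Nullary using (¬_; yes; no)
open import Relation.Nullary.Decidable using (⌊_⌋; toWitness; fromWitness)

fromT : ∀ {b} → T b → b ≡ true
fromT {true} _ = refl

toT : ∀ {b} → b ≡ true → T b
toT refl = tt

t≢f : true ≢ false
t≢f ()

bool-false : ∀ (b : Bool) → (b ≡ true → ⊥) → b ≡ false
bool-false false _ = refl
bool-false true f = ⊥-elim (f refl)

T-∧₁ : ∀ {a b} → T (a ∧ b) → T a
T-∧₁ {true} _ = tt

T-∧₂ : ∀ {a b} → T (a ∧ b) → T b
T-∧₂ {true} t = t

T-∧⁺ : ∀ {a b} → T a → T b → T (a ∧ b)
T-∧⁺ {true} _ t = t

≡ᵇ-refl : ∀ n → (n ≡ᵇ n) ≡ true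
≡ᵇ-refl zero = refl
≡ᵇ-refl (suc n) = ≡ᵇ-refl n

≡ᵇ-≢ : ∀ {m n} → m ≢ n → (m ≡ᵇ n) ≡ false
≡ᵇ-≢ {m} {n} ne = bool-false _ (λ e → ne (≡ᵇ⇒≡ m n (toT e)))

<ᵇ-true : ∀ {m n} → (m <ᵇ n) ≡ true → m < n
<ᵇ-true {m} {n} e = <ᵇ⇒< m n (toT e)

<ᵇ-intro : ∀ {m n} → m < n → (m <ᵇ n) ≡ true
<ᵇ-intro p = fromT (<⇒<ᵇ p)

<ᵇ-false : ∀ {m n} → n ≤ m → (m <ᵇ n) ≡ false
<ᵇ-false p = bool-false _ (λ e → <⇒≱ (<ᵇ-true e) p)

<ᵇ-false⁻ : ∀ {m n} → (m <ᵇ n) ≡ false → n ≤ m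
<ᵇ-false⁻ e = ≮⇒≥ (λ lt → t≢f (trans (sym (<ᵇ-intro lt)) e))

≤ᵇ-true : ∀ {m n} → (m ≤ᵇ n) ≡ true → m ≤ n
≤ᵇ-true {m} {n} e = ≤ᵇ⇒≤ m n (toT e)

≤ᵇ-intro : ∀ {m n} → m ≤ n → (m ≤ᵇ n) ≡ true
≤ᵇ-intro p = fromT (≤⇒≤ᵇ p)

≤ᵇ-false : ∀ {m n} → n < m → (m ≤ᵇ n) ≡ false
≤ᵇ-false p = bool-false _ (λ e → <⇒≱ p (≤ᵇ-true e))

≤ᵇ-false⁻ : ∀ {m n} → (m ≤ᵇ n) ≡ false → n < m
≤ᵇ-false⁻ e = ≰⇒> (λ le → t≢f (trans (sym (≤ᵇ-intro le)) e))

suc[n∸1]≡n : ∀ {n} → 1 ≤ n → suc (n ∸ 1) ≡ n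
suc[n∸1]≡n {suc n} _ = refl

-- Boolean filtering; filterᵇ p is definitionally filter (T? ∘ p), so the
-- library's filter lemmas apply to it directly.

module _ {A : Set} (p : A → Bool) where

  filterᵇ-accept : ∀ {x} xs → p x ≡ true → filterᵇ p (x ∷ xs) ≡ x ∷ filterᵇ p xs
  filterᵇ-accept xs e rewrite e = refl

  filterᵇ-reject : ∀ {x} xs → p x ≡ false → filterᵇ p (x ∷ xs) ≡ filterᵇ p xs
  filterᵇ-reject xs e rewrite e = refl

  ∈-filterᵇ⁻ : ∀ {x} xs → x ∈ filterᵇ p xs → x ∈ xs × p x ≡ true
  ∈-filterᵇ⁻ xs m = let (m' , t) = ∈-filter⁻ (T? ∘ p) {xs = xs} m in m' , fromT t

  ∈-filterᵇ⁺ : ∀ {x} xs → x ∈ xs → p x ≡ true → x ∈ filterᵇ p xs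
  ∈-filterᵇ⁺ xs m e = ∈-filter⁺ (T? ∘ p) m (toT e)

  filterᵇ-all : ∀ xs → (∀ {x} → x ∈ xs → p x ≡ true) → filterᵇ p xs ≡ xs
  filterᵇ-all [] h = refl
  filterᵇ-all (x ∷ xs) h rewrite h (here refl) = cong (x ∷_) (filterᵇ-all xs (h ∘ there))

  filterᵇ-none : ∀ xs → (∀ {x} → x ∈ xs → p x ≡ false) → filterᵇ p xs ≡ []
  filterᵇ-none [] h = refl
  filterᵇ-none (x ∷ xs) h rewrite h (here refl) = filterᵇ-none xs (h ∘ there)

  filterᵇ-[] : ∀ xs → filterᵇ p xs ≡ [] → ∀ {x} → x ∈ xs → p x ≡ false
  filterᵇ-[] xs e {x} m = bool-false (p x) (λ px → case subst (x ∈_) e (∈-filterᵇ⁺ xs m px) of λ ())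

  filterᵇ-concat : ∀ xss → filterᵇ p (concat xss) ≡ concat (map (filterᵇ p) xss)
  filterᵇ-concat [] = refl
  filterᵇ-concat (xs ∷ xss) =
    trans (filter-++ (T? ∘ p) xs (concat xss)) (cong (filterᵇ p xs ++_) (filterᵇ-concat xss))

  filterᵇ-drops : ∀ {x} xs → x ∈ xs → p x ≡ false → length (filterᵇ p xs) < length xs
  filterᵇ-drops xs m e = filter-notAll (T? ∘ p) xs (Any.map (λ { refl t → t≢f (trans (sym (fromT t)) e) }) m)

module _ {A : Set} (p q : A → Bool) (q≡¬p : ∀ x → q x ≡ not (p x)) where

  length-filterᵇ-split : ∀ xs → length xs ≡ length (filterᵇ p xs) + length (filterᵇ q xs)
  length-filterᵇ-split [] = refl
  length-filterᵇ-split (x ∷ xs) with p x in e | q x in e'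
  ... | true | true = ⊥-elim (t≢f (trans (sym e') (trans (q≡¬p x) (cong not e))))
  ... | true | false = cong suc (length-filterᵇ-split xs)
  ... | false | true = trans (cong suc (length-filterᵇ-split xs)) (sym (+-suc _ _))
  ... | false | false = ⊥-elim (t≢f (trans (sym (cong not e)) (trans (sym (q≡¬p x)) e')))

data Distinct {A : Set} : List A → Set where
  []ᵈ : Distinct []
  _∷ᵈ_ : ∀ {x xs} → x ∉ xs → Distinct xs → Distinct (x ∷ xs)

infixr 5 _∷ᵈ_

module _ {A : Set} where

  filter-distinct : (p : A → Bool) {xs : List A} → Distinct xs → Distinct (filterᵇ p xs)
  filter-distinct p []ᵈ = []ᵈ
  filter-distinct p {x ∷ xs} (x∉ ∷ᵈ d) with p x
  ... | true = (x∉ ∘ proj₁ ∘ ∈-filterᵇ⁻ p xs) ∷ᵈ filter-distinct p d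
  ... | false = filter-distinct p d

  map-distinct : ∀ {B : Set} (f : A → B) {xs : List A} →
    (∀ {x y} → x ∈ xs → y ∈ xs → f x ≡ f y → x ≡ y) → Distinct xs → Distinct (map f xs)
  map-distinct f inj []ᵈ = []ᵈ
  map-distinct f {x ∷ xs} inj (x∉ ∷ᵈ d) =
    (λ m → let (y , y∈ , fx≡fy) = ∈-map⁻ f m in x∉ (subst (_∈ xs) (sym (inj (here refl) (there y∈) fx≡fy)) y∈))
    ∷ᵈ map-distinct f (λ a b → inj (there a) (there b)) d

  map-distinct⁻ : ∀ {B : Set} (f : A → B) {xs : List A} → Distinct (map f xs) → Distinct xs
  map-distinct⁻ f {[]} _ = []ᵈ
  map-distinct⁻ f {x ∷ xs} (fx∉ ∷ᵈ d) = (fx∉ ∘ ∈-map⁺ f) ∷ᵈ map-distinct⁻ f d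

  ++-distinct : ∀ {xs ys : List A} → Distinct xs → Distinct ys →
    (∀ {z} → z ∈ xs → z ∈ ys → ⊥) → Distinct (xs ++ ys)
  ++-distinct []ᵈ dys disj = dys
  ++-distinct {x ∷ xs} (x∉ ∷ᵈ dxs) dys disj =
    (λ m → [ x∉ , disj (here refl) ]′ (∈-++⁻ xs m)) ∷ᵈ ++-distinct dxs dys (disj ∘ there)

  split-distinct : (p q : A → Bool) → (∀ x → q x ≡ not (p x)) → (xs : List A) →
    Distinct (filterᵇ p xs) → Distinct (filterᵇ q xs) → Distinct xs
  split-distinct p q q≡¬p [] _ _ = []ᵈ
  split-distinct p q q≡¬p (x ∷ xs) dp dq with p x in e | q x in e'
  ... | true | true = ⊥-elim (t≢f (trans (sym e') (trans (q≡¬p x) (cong not e))))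
  ... | false | false = ⊥-elim (t≢f (trans (sym (cong not e)) (trans (sym (q≡¬p x)) e')))
  split-distinct p q q≡¬p (x ∷ xs) (x∉ ∷ᵈ dp) dq | true | false =
    (λ m → x∉ (∈-filterᵇ⁺ p xs m e)) ∷ᵈ split-distinct p q q≡¬p xs dp dq
  split-distinct p q q≡¬p (x ∷ xs) dp (x∉ ∷ᵈ dq) | false | true =
    (λ m → x∉ (∈-filterᵇ⁺ q xs m e')) ∷ᵈ split-distinct p q q≡¬p xs dp dq

  module _ (_≟ᴬ_ : DecidableEquality A) where

    private
      remove : A → List A → List A
      remove x = filterᵇ (λ y → not ⌊ x ≟ᴬ y ⌋)

      remove-shortens : ∀ {x} S → x ∈ S → suc (length (remove x S)) ≤ length S
      remove-shortens {x} (y ∷ S) (here refl) with x ≟ᴬ x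
      ... | yes _ = s≤s (length-filter (T? ∘ _) S)
      ... | no x≢x = ⊥-elim (x≢x refl)
      remove-shortens {x} (y ∷ S) (there m) with x ≟ᴬ y
      ... | yes _ = m≤n⇒m≤1+n (remove-shortens S m)
      ... | no _ = s≤s (remove-shortens S m)

      ∈-remove : ∀ {x y} S → y ∈ S → x ≢ y → y ∈ remove x S
      ∈-remove {x} {y} S m x≢y = ∈-filterᵇ⁺ (λ z → not ⌊ x ≟ᴬ z ⌋) S m kept
        where
        kept : not ⌊ x ≟ᴬ y ⌋ ≡ true
        kept with x ≟ᴬ y
        ... | yes x≡y = ⊥-elim (x≢y x≡y)
        ... | no _ = refl

    distinct-length : ∀ {L S} → Distinct L → (∀ {x} → x ∈ L → x ∈ S) → length L ≤ length S
    distinct-length {[]} d L⊆S = z≤n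
    distinct-length {x ∷ L} {S} (x∉ ∷ᵈ d) L⊆S =
      ≤-trans (s≤s (distinct-length {L} {remove x S} d L⊆S-x)) (remove-shortens S (L⊆S (here refl)))
      where
      L⊆S-x : ∀ {y} → y ∈ L → y ∈ remove x S
      L⊆S-x m = ∈-remove S (L⊆S (there m)) (λ { refl → x∉ m })

-- countdown k = k, k-1, …, 1: the order in which the values 1…k occur in every
-- element of 𝒟(𝕁_λ, J_μ) when λ has k parts.

countdown : ℕ → List ℕ
countdown zero = []
countdown (suc k) = suc k ∷ countdown k

length-countdown : ∀ k → length (countdown k) ≡ k
length-countdown zero = refl
length-countdown (suc k) = cong suc (length-countdown k)

∈-countdown⁻ : ∀ {v} k → v ∈ countdown k → 1 ≤ v × v ≤ k
∈-countdown⁻ (suc k) (here refl) = s≤s z≤n , ≤-refl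
∈-countdown⁻ (suc k) (there m) = let (1≤v , v≤k) = ∈-countdown⁻ k m in 1≤v , m≤n⇒m≤1+n v≤k

∈-countdown⁺ : ∀ {v} k → 1 ≤ v → v ≤ k → v ∈ countdown k
∈-countdown⁺ {suc v} zero 1≤v ()
∈-countdown⁺ {v} (suc k) 1≤v v≤k with v ≟ suc k
... | yes refl = here refl
... | no v≢ = there (∈-countdown⁺ k 1≤v (≤-pred (≤∧≢⇒< v≤k v≢)))

countdown-distinct : ∀ k → Distinct (countdown k)
countdown-distinct zero = []ᵈ
countdown-distinct (suc k) = (1+n≰n ∘ proj₂ ∘ ∈-countdown⁻ k) ∷ᵈ countdown-distinct k

IsPermList : ℕ → List ℕ → Set
IsPermList m L = length L ≡ m × Distinct L × (∀ {x} → x ∈ L → 1 ≤ x × x ≤ m)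

-- Such a list contains every value 1…m (pigeonhole).
permList-complete : ∀ {m L} → IsPermList m L → ∀ v → 1 ≤ v → v ≤ m → v ∈ L
permList-complete {m} {L} (len , d , range) v 1≤v v≤m with v ∈? L
... | yes v∈L = v∈L
... | no v∉L = ⊥-elim (<-irrefl refl (≤-trans (≤-reflexive (cong suc (sym len))) too-long))
  where
  too-long : suc (length L) ≤ m
  too-long = subst (suc (length L) ≤_) (length-countdown m)
    (distinct-length ℕ._≟_ (v∉L ∷ᵈ d) λ
      { (here refl) → ∈-countdown⁺ m 1≤v v≤m
      ; (there x∈L) → let (1≤x , x≤m) = range x∈L in ∈-countdown⁺ m 1≤x x≤m })

-- The key facts: deleting
-- entries of L, or shifting all its values, does not change how the positions
-- of the remaining values compare.

pos-step : Bool → ℕ → ℕ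
pos-step isHead p = if isHead then 1 else (if 0 <ᵇ p then suc p else 0)

SameOrder : ℕ → ℕ → ℕ → ℕ → Set
SameOrder p q p' q' = ((0 <ᵇ p) ≡ (0 <ᵇ p')) × ((0 <ᵇ q) ≡ (0 <ᵇ q')) × ((p <ᵇ q) ≡ (p' <ᵇ q'))

pos-step-order : ∀ a b {p q p' q'} → SameOrder p q p' q' →
  SameOrder (pos-step a p) (pos-step b q) (pos-step a p') (pos-step b q')
pos-step-order true true _ = refl , refl , refl
pos-step-order true false {q = zero} {q' = zero} _ = refl , refl , refl
pos-step-order true false {q = suc q} {q' = suc q'} _ = refl , refl , refl
pos-step-order true false {q = zero} {q' = suc q'} (_ , () , _)
pos-step-order true false {q = suc q} {q' = zero} (_ , () , _)
pos-step-order false true {p = zero} {p' = zero} _ = refl , refl , refl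
pos-step-order false true {p = suc p} {p' = suc p'} _ = refl , refl , refl
pos-step-order false true {p = zero} {p' = suc p'} (() , _ , _)
pos-step-order false true {p = suc p} {p' = zero} (() , _ , _)
pos-step-order false false {zero} {zero} {zero} {zero} h = h
pos-step-order false false {zero} {suc q} {zero} {suc q'} h = refl , refl , refl
pos-step-order false false {suc p} {zero} {suc p'} {zero} h = refl , refl , refl
pos-step-order false false {suc p} {suc q} {suc p'} {suc q'} (_ , _ , h) = refl , refl , h
pos-step-order false false {zero} {_} {suc p'} {_} (() , _ , _)
pos-step-order false false {suc p} {_} {zero} {_} (() , _ , _)
pos-step-order false false {zero} {zero} {zero} {suc q'} (_ , () , _)
pos-step-order false false {zero} {suc q} {zero} {zero} (_ , () , _)
pos-step-order false false {suc p} {zero} {suc p'} {suc q'} (_ , () , _)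
pos-step-order false false {suc p} {suc q} {suc p'} {zero} (_ , () , _)

pos-skip-order : ∀ {P Q p q} → SameOrder P Q p q → SameOrder P Q (pos-step false p) (pos-step false q)
pos-skip-order {P} {Q} {zero} {zero} h = h
pos-skip-order {zero} {suc Q} {zero} {suc q} h = refl , refl , refl
pos-skip-order {suc P} {zero} {suc p} {zero} h = refl , refl , refl
pos-skip-order {suc P} {suc Q} {suc p} {suc q} (_ , _ , h) = refl , refl , h
pos-skip-order {zero} {_} {suc p} {_} (() , _ , _)
pos-skip-order {suc P} {_} {zero} {_} (() , _ , _)
pos-skip-order {zero} {zero} {zero} {suc q} (_ , () , _)
pos-skip-order {suc P} {zero} {suc p} {suc q} (_ , () , _)
pos-skip-order {suc P} {suc Q} {suc p} {zero} (_ , () , _)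

pos-head : ∀ x L → pos (x ∷ L) x ≡ 1
pos-head x L rewrite ≡ᵇ-refl x = refl

pos-other : ∀ {v} x L → v ≢ x → pos (x ∷ L) v ≡ pos-step false (pos L v)
pos-other {v} x L v≢x rewrite ≡ᵇ-≢ v≢x = refl

pos-present : ∀ {v} L → v ∈ L → (0 <ᵇ pos L v) ≡ true
pos-present {v} (x ∷ L) (here refl) rewrite ≡ᵇ-refl v = refl
pos-present {v} (x ∷ L) (there m) with v ≡ᵇ x
... | true = refl
... | false rewrite pos-present L m = refl

kept≢dropped : (p : ℕ → Bool) {c x : ℕ} → p c ≡ true → p x ≡ false → c ≢ x
kept≢dropped p pc px refl = t≢f (trans (sym pc) px)

pos-filter-order : (p : ℕ → Bool) {a b : ℕ} → p a ≡ true → p b ≡ true → (L : List ℕ) →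
  SameOrder (pos (filterᵇ p L) a) (pos (filterᵇ p L) b) (pos L a) (pos L b)
pos-filter-order p pa pb [] = refl , refl , refl
pos-filter-order p {a} {b} pa pb (x ∷ L) with p x in px
... | true = pos-step-order (a ≡ᵇ x) (b ≡ᵇ x) {pos (filterᵇ p L) a} {pos (filterᵇ p L) b} {pos L a} {pos L b}
  (pos-filter-order p pa pb L)
... | false rewrite ≡ᵇ-≢ (kept≢dropped p pa px) | ≡ᵇ-≢ (kept≢dropped p pb px) =
  pos-skip-order {pos (filterᵇ p L) a} {pos (filterᵇ p L) b} {pos L a} {pos L b} (pos-filter-order p pa pb L)

≡ᵇ-shift : ∀ {k x} j → k < x → (j ≡ᵇ x ∸ k) ≡ (j + k ≡ᵇ x)
≡ᵇ-shift {k} {x} j k<x with j ≟ x ∸ k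
... | yes refl rewrite ≡ᵇ-refl (x ∸ k) | m∸n+n≡m (<⇒≤ k<x) | ≡ᵇ-refl x = refl
... | no j≢ rewrite ≡ᵇ-≢ j≢ | ≡ᵇ-≢ {j + k} {x} (λ e → j≢ (trans (sym (m+n∸n≡m j k)) (cong (_∸ k) e))) = refl

pos-map-∸ : ∀ k (M : List ℕ) → (∀ {x} → x ∈ M → k < x) → ∀ j → pos (map (_∸ k) M) j ≡ pos M (j + k)
pos-map-∸ k [] h j = refl
pos-map-∸ k (x ∷ M) h j rewrite ≡ᵇ-shift j (h (here refl)) | pos-map-∸ k M (h ∘ there) j = refl

nth-++ˡ : ∀ A B j → 1 ≤ j → j ≤ length A → nth (A ++ B) j ≡ nth A j
nth-++ˡ (a ∷ A) B (suc zero) _ _ = refl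
nth-++ˡ (a ∷ A) B (suc (suc j)) _ (s≤s le) = nth-++ˡ A B (suc j) (s≤s z≤n) le

nth-++ʳ : ∀ A B j → nth (A ++ B) (length A + suc j) ≡ nth B (suc j)
nth-++ʳ [] B j = refl
nth-++ʳ (a ∷ A) B j rewrite +-suc (length A) j = trans (cong (nth (A ++ B)) (sym (+-suc (length A) j))) (nth-++ʳ A B j)

data Sorted : List ℕ → Set where
  []ˢ : Sorted []
  _∷ˢ_ : ∀ {x xs} → (∀ {y} → y ∈ xs → x ≤ y) → Sorted xs → Sorted (x ∷ xs)

infixr 5 _∷ˢ_

NoDescents : List ℕ → Set
NoDescents L = ∀ j → 1 ≤ j → suc j ≤ length L → (nth L (suc j) <ᵇ nth L j) ≡ false

sorted⇒noDescents : ∀ {L} → Sorted L → NoDescents L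
sorted⇒noDescents {x ∷ y ∷ L} (h ∷ˢ s) (suc zero) _ _ = <ᵇ-false (h (here refl))
sorted⇒noDescents {x ∷ y ∷ L} (h ∷ˢ s) (suc (suc j)) _ (s≤s le) = sorted⇒noDescents s (suc j) (s≤s z≤n) le
sorted⇒noDescents {x ∷ []} _ (suc zero) _ (s≤s ())
sorted⇒noDescents {x ∷ []} _ (suc (suc j)) _ (s≤s ())

noDescents⇒sorted : ∀ L → NoDescents L → Sorted L
noDescents⇒sorted [] _ = []ˢ
noDescents⇒sorted (x ∷ []) _ = (λ ()) ∷ˢ []ˢ
noDescents⇒sorted (x ∷ y ∷ L) nd with noDescents⇒sorted (y ∷ L) (λ { (suc j) p q → nd (suc (suc j)) (s≤s z≤n) (s≤s q) })
... | y≤ ∷ˢ s = x≤ ∷ˢ y≤ ∷ˢ s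
  where
  x≤y : x ≤ y
  x≤y = <ᵇ-false⁻ (nd 1 (s≤s z≤n) (s≤s (s≤s z≤n)))
  x≤ : ∀ {z} → z ∈ y ∷ L → x ≤ z
  x≤ (here refl) = x≤y
  x≤ (there m) = ≤-trans x≤y (y≤ m)

sorted-filter : (p : ℕ → Bool) {L : List ℕ} → Sorted L → Sorted (filterᵇ p L)
sorted-filter p []ˢ = []ˢ
sorted-filter p {x ∷ L} (h ∷ˢ s) with p x
... | true = (h ∘ proj₁ ∘ ∈-filterᵇ⁻ p L) ∷ˢ sorted-filter p s
... | false = sorted-filter p s

sorted-map : (f : ℕ → ℕ) → (∀ {a b} → a ≤ b → f a ≤ f b) → {L : List ℕ} → Sorted L → Sorted (map f L)
sorted-map f mono []ˢ = []ˢ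
sorted-map f mono {x ∷ L} (h ∷ˢ s) = fx≤ ∷ˢ sorted-map f mono s
  where
  fx≤ : ∀ {z} → z ∈ map f L → f x ≤ z
  fx≤ m with ∈-map⁻ f m
  ... | y , y∈ , refl = mono (h y∈)

-- Des_R(w) ⊆ Δ ∖ J_μ says that every right
-- descent of w sits at a proper partial sum of μ, i.e. w is increasing on each
-- of the consecutive blocks of sizes μ₁, μ₂, …  (blocks⇒rightDescents and
-- rightDescents⇒blocks below).

≡ᵇ-+ : ∀ x a b → (x + a ≡ᵇ x + b) ≡ (a ≡ᵇ b)
≡ᵇ-+ zero a b = refl
≡ᵇ-+ (suc x) a b = ≡ᵇ-+ x a b

any-map : ∀ (f : ℕ → Bool) (g : ℕ → ℕ) P → any f (map g P) ≡ any (f ∘ g) P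
any-map f g [] = refl
any-map f g (p ∷ P) = cong (f (g p) ∨_) (any-map f g P)

any-cong : ∀ {f g : ℕ → Bool} → (∀ z → f z ≡ g z) → ∀ P → any f P ≡ any g P
any-cong f≗g [] = refl
any-cong f≗g (p ∷ P) = cong₂ _∨_ (f≗g p) (any-cong f≗g P)

any-false : ∀ {f : ℕ → Bool} → (∀ z → f z ≡ false) → ∀ P → any f P ≡ false
any-false f≗false [] = refl
any-false f≗false (p ∷ P) rewrite f≗false p = any-false f≗false P

partialSum-below : ∀ x s j → j < x → (j ∈ᵇ properPartialSums (x ∷ s)) ≡ false
partialSum-below x [] j j<x = refl
partialSum-below x (y ∷ ys) j j<x
  rewrite ≡ᵇ-≢ (<⇒≢ j<x) | any-map (j ≡ᵇ_) (x +_) (properPartialSums (y ∷ ys)) =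
  any-false (λ z → ≡ᵇ-≢ (λ e → <⇒≱ j<x (≤-trans (m≤m+n x z) (≤-reflexive (sym e))))) (properPartialSums (y ∷ ys))

partialSum-first : ∀ x y ys → (x ∈ᵇ properPartialSums (x ∷ y ∷ ys)) ≡ true
partialSum-first x y ys rewrite ≡ᵇ-refl x = refl

partialSum-above : ∀ x s i → ((x + suc i) ∈ᵇ properPartialSums (x ∷ s)) ≡ (suc i ∈ᵇ properPartialSums s)
partialSum-above x [] i = refl
partialSum-above x (y ∷ ys) i
  rewrite ≡ᵇ-≢ {x + suc i} {x} (λ e → m≢1+m+n x (sym (trans (sym (+-suc x i)) e)))
        | any-map (x + suc i ≡ᵇ_) (x +_) (properPartialSums (y ∷ ys)) =
  any-cong (≡ᵇ-+ x (suc i)) (properPartialSums (y ∷ ys))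

compare-with : ∀ x j → j < x ⊎ j ≡ x ⊎ Σ ℕ (λ i → j ≡ x + suc i)
compare-with x j with <-cmp j x
... | tri< j<x _ _ = inj₁ j<x
... | tri≈ _ j≡x _ = inj₂ (inj₁ j≡x)
... | tri> _ _ j>x = inj₂ (inj₂ (j ∸ suc x , trans (sym (m+[n∸m]≡n j>x)) (sym (+-suc x (j ∸ suc x)))))

RightDescentsIn : List ℕ → List ℕ → Set
RightDescentsIn s L = ∀ j → 1 ≤ j → suc j ≤ length L →
  (nth L (suc j) <ᵇ nth L j) ≡ true → (j ∈ᵇ properPartialSums s) ≡ true

rightDescents-∷⁻ : ∀ {x} s B L' → length B ≡ x →
  RightDescentsIn (x ∷ s) (B ++ L') → Sorted B × RightDescentsIn s L'
rightDescents-∷⁻ s B L' refl h = noDescents⇒sorted B inB , inL'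
  where
  inB : NoDescents B
  inB j 1≤j j<|B| = bool-false _ λ desc → t≢f (trans (sym (h j 1≤j (≤-trans j<|B| (length-++-≤ˡ B))
    (trans (cong₂ _<ᵇ_ (nth-++ˡ B L' (suc j) (s≤s z≤n) j<|B|) (nth-++ˡ B L' j 1≤j (≤-trans (n≤1+n j) j<|B|))) desc)))
    (partialSum-below (length B) s j j<|B|))
  inL' : RightDescentsIn s L'
  inL' (suc i) _ bound desc = trans (sym (partialSum-above (length B) s i))
    (h (length B + suc i) (≤-trans (s≤s z≤n) (m≤n+m (suc i) (length B))) bound' desc')
    where
    bound' : suc (length B + suc i) ≤ length (B ++ L')
    bound' = subst₂ _≤_ (+-suc (length B) (suc i)) (sym (length-++ B)) (+-monoʳ-≤ (length B) bound)
    desc' : (nth (B ++ L') (suc (length B + suc i)) <ᵇ nth (B ++ L') (length B + suc i)) ≡ true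
    desc' rewrite sym (+-suc (length B) (suc i)) | nth-++ʳ B L' (suc i) | nth-++ʳ B L' i = desc

-- Prepending an increasing block of size |B| (not the last one unless L' = []).
rightDescents-∷⁺ : ∀ s B L' → Sorted B → RightDescentsIn s L' → (s ≡ [] → L' ≡ []) →
  RightDescentsIn (length B ∷ s) (B ++ L')
rightDescents-∷⁺ s B L' sB h last j 1≤j bound desc with compare-with (length B) j
... | inj₁ j<|B| = ⊥-elim (t≢f (trans (sym desc) (trans
  (cong₂ _<ᵇ_ (nth-++ˡ B L' (suc j) (s≤s z≤n) j<|B|) (nth-++ˡ B L' j 1≤j (≤-trans (n≤1+n j) j<|B|)))
  (sorted⇒noDescents sB j 1≤j j<|B|))))
rightDescents-∷⁺ [] B L' sB h last j 1≤j bound desc | inj₂ (inj₁ refl)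
  rewrite last refl | ++-identityʳ B = ⊥-elim (1+n≰n bound)
rightDescents-∷⁺ (y ∷ ys) B L' sB h last j 1≤j bound desc | inj₂ (inj₁ refl) = partialSum-first (length B) y ys
rightDescents-∷⁺ s B L' sB h last j 1≤j bound desc | inj₂ (inj₂ (i , refl)) =
  trans (partialSum-above (length B) s i) (h (suc i) (s≤s z≤n) bound' desc')
  where
  bound' : suc (suc i) ≤ length L'
  bound' = +-cancelˡ-≤ (length B) _ _ (subst₂ _≤_ (sym (+-suc (length B) (suc i))) (length-++ B) bound)
  desc' : (nth L' (suc (suc i)) <ᵇ nth L' (suc i)) ≡ true
  desc' = trans (cong₂ _<ᵇ_ (trans (sym (nth-++ʳ B L' (suc i))) (cong (nth (B ++ L')) (+-suc (length B) (suc i))))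
    (sym (nth-++ʳ B L' i))) desc

data Blocks : List ℕ → List (List ℕ) → Set where
  []ᵇ : Blocks [] []
  block : ∀ {x s B Bs} → length B ≡ x → Sorted B → Blocks s Bs → Blocks (x ∷ s) (B ∷ Bs)

blocks-length : ∀ {s Bs} → Blocks s Bs → length Bs ≡ length s
blocks-length []ᵇ = refl
blocks-length (block _ _ b) = cong suc (blocks-length b)

blocks-sorted : ∀ {s Bs} → Blocks s Bs → ∀ {B} → B ∈ Bs → Sorted B
blocks-sorted (block _ sB b) (here refl) = sB
blocks-sorted (block _ sB b) (there m) = blocks-sorted b m

blocks⇒rightDescents : ∀ {s Bs} → Blocks s Bs → RightDescentsIn s (concat Bs)
blocks⇒rightDescents []ᵇ j _ ()
blocks⇒rightDescents (block {s = s} {B = B} {Bs = Bs} refl sB b) =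
  rightDescents-∷⁺ s B (concat Bs) sB (blocks⇒rightDescents b) (lastBlock b)
  where
  lastBlock : ∀ {s Bs} → Blocks s Bs → s ≡ [] → concat Bs ≡ []
  lastBlock []ᵇ _ = refl
  lastBlock (block _ _ _) ()

splitBy : List ℕ → List ℕ → List (List ℕ)
splitBy [] L = []
splitBy (x ∷ s) L = take x L ∷ splitBy s (drop x L)

rightDescents⇒blocks : ∀ s L → length L ≡ sum s → RightDescentsIn s L →
  Blocks s (splitBy s L) × concat (splitBy s L) ≡ L
rightDescents⇒blocks [] [] len h = []ᵇ , refl
rightDescents⇒blocks (x ∷ s) L len h =
  let (sorted , h') = rightDescents-∷⁻ s (take x L) (drop x L) |take|
                        (subst (RightDescentsIn (x ∷ s)) (sym (take++drop≡id x L)) h)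
      (b , L'≡) = rightDescents⇒blocks s (drop x L) |drop| h'
  in block |take| sorted b , trans (cong (take x L ++_) L'≡) (take++drop≡id x L)
  where
  |take| : length (take x L) ≡ x
  |take| = trans (length-take x L) (m≤n⇒m⊓n≡m (subst (x ≤_) (sym len) (m≤m+n x (sum s))))
  |drop| : length (drop x L) ≡ sum s
  |drop| = trans (length-drop x L) (trans (cong (_∸ x) len) (m+n∸m≡n x (sum s)))

take-++ : ∀ (B C : List ℕ) → take (length B) (B ++ C) ≡ B
take-++ [] C = refl
take-++ (b ∷ B) C = cong (b ∷_) (take-++ B C)

drop-++ : ∀ (B C : List ℕ) → drop (length B) (B ++ C) ≡ C
drop-++ [] C = refl
drop-++ (b ∷ B) C = drop-++ B C

splitBy-blocks : ∀ {s Bs} → Blocks s Bs → splitBy s (concat Bs) ≡ Bs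
splitBy-blocks []ᵇ = refl
splitBy-blocks (block {B = B} {Bs = Bs} refl sB b)
  rewrite take-++ B (concat Bs) | drop-++ B (concat Bs) = cong (B ∷_) (splitBy-blocks b)

positive : ℕ → Bool
positive x = 1 ≤ᵇ x

blocks-dropEmpty : ∀ {s Bs} → Blocks s Bs →
  Σ (List (List ℕ)) λ Bs' → Blocks (filterᵇ positive s) Bs' × concat Bs' ≡ concat Bs
blocks-dropEmpty []ᵇ = [] , []ᵇ , refl
blocks-dropEmpty (block {x = zero} {B = []} refl sB b) = blocks-dropEmpty b
blocks-dropEmpty (block {x = suc x} {B = B} e sB b) =
  let (Bs' , b' , same) = blocks-dropEmpty b in B ∷ Bs' , block e sB b' , cong (B ++_) same

blocks-addEmpty : ∀ s {Bs} → Blocks (filterᵇ positive s) Bs →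
  Σ (List (List ℕ)) λ Bs' → Blocks s Bs' × concat Bs' ≡ concat Bs
blocks-addEmpty [] []ᵇ = [] , []ᵇ , refl
blocks-addEmpty (zero ∷ s) b = let (Bs' , b' , same) = blocks-addEmpty s b in [] ∷ Bs' , block refl []ˢ b' , same
blocks-addEmpty (suc x ∷ s) (block {B = B} e sB b) =
  let (Bs' , b' , same) = blocks-addEmpty s b in B ∷ Bs' , block e sB b' , cong (B ++_) same

AllPositive : List ℕ → Set
AllPositive ν = ∀ {y} → y ∈ ν → 1 ≤ y

all-true⁻ : ∀ (p : ℕ → Bool) ν → T (all p ν) → ∀ {y} → y ∈ ν → p y ≡ true
all-true⁻ p (x ∷ ν) t (here refl) = fromT (T-∧₁ t)
all-true⁻ p (x ∷ ν) t (there m) = all-true⁻ p ν (T-∧₂ {p x} t) m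

all-true⁺ : ∀ (p : ℕ → Bool) ν → (∀ {y} → y ∈ ν → p y ≡ true) → T (all p ν)
all-true⁺ p [] h = tt
all-true⁺ p (x ∷ ν) h = T-∧⁺ (toT (h (here refl))) (all-true⁺ p ν (h ∘ there))

partition-positive : ∀ {n ν} → IsPartition n ν → AllPositive ν
partition-positive {ν = ν} (_ , t , _) m = ≤ᵇ-true (all-true⁻ _ ν t m)

decreasing-head : ∀ {x xs} → Decreasing (x ∷ xs) → ∀ {y} → y ∈ xs → y ≤ x
decreasing-head (dec-∷ le d) (here refl) = le
decreasing-head (dec-∷ le d) (there m) = ≤-trans (decreasing-head d m) le

length≤sum : ∀ ν → AllPositive ν → length ν ≤ sum ν
length≤sum [] _ = z≤n
length≤sum (x ∷ ν) pos = +-mono-≤ (pos (here refl)) (length≤sum ν (pos ∘ there))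

last-part-≤ : ∀ ν k → Decreasing ν → length ν ≡ suc k → ∀ {y} → y ∈ ν → part ν (suc k) ≤ y
last-part-≤ (x ∷ []) zero d l (here refl) = ≤-refl
last-part-≤ (x ∷ y ∷ ys) (suc k) (dec-∷ le d) l (here refl) = ≤-trans (last-part-≤ (y ∷ ys) k d (suc-injective l) (here refl)) le
last-part-≤ (x ∷ y ∷ ys) (suc k) (dec-∷ le d) l (there m) = last-part-≤ (y ∷ ys) k d (suc-injective l) m

last-part-∈ : ∀ ν k → length ν ≡ suc k → part ν (suc k) ∈ ν
last-part-∈ (x ∷ []) zero l = here refl
last-part-∈ (x ∷ y ∷ ys) (suc k) l = there (last-part-∈ (y ∷ ys) k (suc-injective l))

part-beyond : ∀ ν k → length ν < k → part ν k ≡ 0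
part-beyond [] k _ = refl
part-beyond (x ∷ xs) (suc (suc k)) (s≤s lt) = part-beyond xs (suc k) lt

cut-positive : ∀ t ν → AllPositive (cut t ν)
cut-positive t ν m = ≤ᵇ-true (proj₂ (∈-filterᵇ⁻ positive (map (_∸ t) ν) m))

sum-positive : ∀ X → sum (filterᵇ positive X) ≡ sum X
sum-positive [] = refl
sum-positive (zero ∷ X) = sum-positive X
sum-positive (suc x ∷ X) = cong (suc x +_) (sum-positive X)

+-interchange : ∀ a b c d → (a + b) + (c + d) ≡ (a + c) + (b + d)
+-interchange = solve 4 (λ a b c d → (a :+ b) :+ (c :+ d) := (a :+ c) :+ (b :+ d)) refl

sum-map-∸ : ∀ t ν → (∀ {y} → y ∈ ν → t ≤ y) → sum (map (_∸ t) ν) + length ν * t ≡ sum ν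
sum-map-∸ t [] h = refl
sum-map-∸ t (y ∷ ν) h = trans (+-interchange (y ∸ t) _ t _)
  (cong₂ _+_ (m∸n+n≡m (h (here refl))) (sum-map-∸ t ν (h ∘ there)))

sum-cut : ∀ t ν → (∀ {y} → y ∈ ν → t ≤ y) → sum (cut t ν) ≡ sum ν ∸ length ν * t
sum-cut t ν h = trans (sum-positive (map (_∸ t) ν))
  (trans (sym (m+n∸n≡m (sum (map (_∸ t) ν)) (length ν * t))) (cong (_∸ length ν * t) (sum-map-∸ t ν h)))

cut-map : ∀ t ν → (∀ {y} → y ∈ ν → t < y) → cut t ν ≡ map (_∸ t) ν
cut-map t ν h = filterᵇ-all positive (map (_∸ t) ν) stays
  where
  stays : ∀ {x} → x ∈ map (_∸ t) ν → positive x ≡ true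
  stays m with ∈-map⁻ (_∸ t) m
  ... | y , y∈ , refl = ≤ᵇ-intro (subst (_≤ y ∸ t) (m+n∸n≡m 1 t) (∸-monoˡ-≤ t (h y∈)))

decreasing-map-∸ : ∀ t {ν} → Decreasing ν → Decreasing (map (_∸ t) ν)
decreasing-map-∸ t dec-[] = dec-[]
decreasing-map-∸ t dec-[x] = dec-[x]
decreasing-map-∸ t (dec-∷ le d) = dec-∷ (∸-monoˡ-≤ t le) (decreasing-map-∸ t d)

cut-partition : ∀ n k t ν → IsPartition n ν → length ν ≡ k → (∀ {y} → y ∈ ν → t < y) →
  IsPartition (n ∸ k * t) (cut t ν) × length (cut t ν) ≡ k
cut-partition n k t ν (d , _ , sν) l h =
  (subst Decreasing (sym (cut-map t ν h)) (decreasing-map-∸ t d)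
    , all-true⁺ positive (cut t ν) (≤ᵇ-intro ∘ cut-positive t ν)
    , trans (sum-cut t ν (<⇒≤ ∘ h)) (cong₂ _∸_ sν (cong (_* t) l)))
  , trans (cong length (cut-map t ν h)) (trans (length-map _ ν) l)

cut-shortens : ∀ t ν → t ∈ ν → length (cut t ν) < length ν
cut-shortens t ν t∈ν = subst (length (cut t ν) <_) (length-map _ ν)
  (filterᵇ-drops positive (map (_∸ t) ν) (∈-map⁺ (_∸ t) t∈ν) (cong (1 ≤ᵇ_) (n∸n≡0 t)))

cut-zero : ∀ ν → AllPositive ν → cut 0 ν ≡ ν
cut-zero ν pos = trans (cong (filterᵇ positive) (map-id ν)) (filterᵇ-all positive ν (≤ᵇ-intro ∘ pos))
  where
  map-id : ∀ ν → map (_∸ 0) ν ≡ ν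
  map-id [] = refl
  map-id (x ∷ ν) = cong (x ∷_) (map-id ν)

m∸[1+n]≡m∸n∸1 : ∀ m n → m ∸ suc n ≡ m ∸ n ∸ 1
m∸[1+n]≡m∸n∸1 m n = trans (cong (m ∸_) (+-comm 1 n)) (sym (∸-+-assoc m n 1))

filterᵇ-cons-cong : ∀ (p : ℕ → Bool) c {xs ys} → filterᵇ p xs ≡ filterᵇ p ys → filterᵇ p (c ∷ xs) ≡ filterᵇ p (c ∷ ys)
filterᵇ-cons-cong p c e with p c
... | true = cong (c ∷_) e
... | false = e

cut-suc : ∀ t ν → cut 1 (cut t ν) ≡ cut (suc t) ν
cut-suc t [] = refl
cut-suc t (y ∷ ν) with y ∸ t in e
... | zero = trans (cut-suc t ν) (sym (filterᵇ-reject positive {y ∸ suc t} (map (_∸ suc t) ν)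
  (cong (1 ≤ᵇ_) (trans (m∸[1+n]≡m∸n∸1 y t) (cong (_∸ 1) e)))))
... | suc z rewrite m∸[1+n]≡m∸n∸1 y t | e = filterᵇ-cons-cong positive z (cut-suc t ν)

count-cut : ∀ i ν → length (filterᵇ (λ y → suc (suc i) ≤ᵇ y) ν) ≡ length (filterᵇ (λ y → suc i ≤ᵇ y) (cut 1 ν))
count-cut i [] = refl
count-cut i (zero ∷ ν) = count-cut i ν
count-cut i (suc zero ∷ ν) = count-cut i ν
count-cut i (suc (suc y) ∷ ν) with i <ᵇ suc y
... | true = cong suc (count-cut i ν)
... | false = count-cut i ν

map-applyUpTo : ∀ (f g : ℕ → ℕ) n → map f (applyUpTo g n) ≡ applyUpTo (f ∘ g) n
map-applyUpTo f g zero = refl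
map-applyUpTo f g (suc n) = cong (f (g 0) ∷_) (map-applyUpTo f (g ∘ suc) n)

applyUpTo-cong : ∀ {f g : ℕ → ℕ} → (∀ i → f i ≡ g i) → ∀ n → applyUpTo f n ≡ applyUpTo g n
applyUpTo-cong f≗g zero = refl
applyUpTo-cong f≗g (suc n) = cong₂ _∷_ (f≗g 0) (applyUpTo-cong (f≗g ∘ suc) n)

cut-one-column : ∀ ν → (∀ {y} → y ∈ ν → y ≤ 1) → cut 1 ν ≡ []
cut-one-column [] h = refl
cut-one-column (zero ∷ ν) h = cut-one-column ν (h ∘ there)
cut-one-column (suc zero ∷ ν) h = cut-one-column ν (h ∘ there)
cut-one-column (suc (suc y) ∷ ν) h with h (here refl)
... | s≤s ()

count-positive : ∀ ν → AllPositive ν → length (filterᵇ positive ν) ≡ length ν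
count-positive ν pos = cong length (filterᵇ-all positive ν (≤ᵇ-intro ∘ pos))

dual-first-column : ∀ x xs → Decreasing (x ∷ xs) → AllPositive (x ∷ xs) →
  dual (x ∷ xs) ≡ length (x ∷ xs) ∷ dual (cut 1 (x ∷ xs))
dual-first-column zero xs d pos = ⊥-elim (1+n≰n (pos (here refl)))
dual-first-column (suc zero) xs d pos =
  cong₂ _∷_ (count-positive (1 ∷ xs) pos) (sym (cong dual (cut-one-column xs (decreasing-head d))))
dual-first-column (suc (suc x)) xs d pos =
  cong₂ _∷_ (count-positive (suc (suc x) ∷ xs) pos)
    (trans (map-applyUpTo columnLength suc (suc x))
      (trans (applyUpTo-cong (λ i → count-cut i (suc (suc x) ∷ xs)) (suc x))
        (sym (map-applyUpTo _ (λ i → i) (suc x)))))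
  where
  columnLength : ℕ → ℕ
  columnLength i = length (filterᵇ (λ y → suc i ≤ᵇ y) (suc (suc x) ∷ xs))

dual-nonempty : ∀ ν → AllPositive ν → ν ≢ [] → Σ ℕ λ d → Σ (List ℕ) λ ds → dual ν ≡ d ∷ ds
dual-nonempty [] pos ν≢[] = ⊥-elim (ν≢[] refl)
dual-nonempty (zero ∷ ν) pos ν≢[] = ⊥-elim (1+n≰n (pos (here refl)))
dual-nonempty (suc y ∷ ν) pos ν≢[] = _ , _ , refl

leftDescent : List ℕ → ℕ → Bool
leftDescent L j = pos L (suc j) <ᵇ pos L j

rightDescent : List ℕ → ℕ → Bool
rightDescent L j = nth L (suc j) <ᵇ nth L j

-- The test descCondᵇ m J K w of Defs is, definitionally, this test on values w.
descentTest : ℕ → Roots → Roots → List ℕ → Bool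
descentTest m J K L =
  all (λ j → (leftDescent L j ⇔ᵇ not (J j)) ∧ (rightDescent L j ⇒ᵇ not (K j))) (simpleIdx m)

LeftDescentsOf : ℕ → List ℕ → List ℕ → Set
LeftDescentsOf m λ' L = ∀ j → 1 ≤ j → suc j ≤ m → leftDescent L j ≡ not (j ∈ᵇ properPartialSums (dual λ'))

Admissible : ℕ → List ℕ → List ℕ → List ℕ → Set
Admissible m λ' μ L = IsPermList m L × LeftDescentsOf m λ' L × RightDescentsIn μ L

all-simpleIdx⁻ : ∀ f m → T (all f (simpleIdx m)) → ∀ j → 1 ≤ j → suc j ≤ m → f j ≡ true
all-simpleIdx⁻ f m t (suc i) _ le = go (λ i → i) (m ∸ 1) t i (∸-monoˡ-≤ 1 le)
  where
  go : ∀ g n → T (all f (map suc (applyUpTo g n))) → ∀ i → i < n → f (suc (g i)) ≡ true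
  go g (suc n) t zero _ = fromT (T-∧₁ t)
  go g (suc n) t (suc i) (s≤s lt) = go (g ∘ suc) n (T-∧₂ {f (suc (g 0))} t) i lt

all-simpleIdx⁺ : ∀ f m → (∀ j → 1 ≤ j → suc j ≤ m → f j ≡ true) → T (all f (simpleIdx m))
all-simpleIdx⁺ f zero h = tt
all-simpleIdx⁺ f (suc m) h = go (λ i → i) m (λ i lt → h (suc i) (s≤s z≤n) (s≤s lt))
  where
  go : ∀ g n → (∀ i → i < n → f (suc (g i)) ≡ true) → T (all f (map suc (applyUpTo g n)))
  go g zero h = tt
  go g (suc n) h = T-∧⁺ (toT (h 0 (s≤s z≤n))) (go (g ∘ suc) n (λ i lt → h (suc i) (s≤s lt)))

⇔ᵇ∧⇒ᵇ⁻ : ∀ a b c d → ((a ⇔ᵇ b) ∧ (c ⇒ᵇ d)) ≡ true → (a ≡ b) × (c ≡ true → d ≡ true)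
⇔ᵇ∧⇒ᵇ⁻ true true true true _ = refl , λ _ → refl
⇔ᵇ∧⇒ᵇ⁻ true true false d _ = refl , λ ()
⇔ᵇ∧⇒ᵇ⁻ false false true true _ = refl , λ _ → refl
⇔ᵇ∧⇒ᵇ⁻ false false false d _ = refl , λ ()
⇔ᵇ∧⇒ᵇ⁻ true false _ _ ()
⇔ᵇ∧⇒ᵇ⁻ false true _ _ ()
⇔ᵇ∧⇒ᵇ⁻ true true true false ()
⇔ᵇ∧⇒ᵇ⁻ false false true false ()

⇔ᵇ∧⇒ᵇ⁺ : ∀ a b c d → a ≡ b → (c ≡ true → d ≡ true) → ((a ⇔ᵇ b) ∧ (c ⇒ᵇ d)) ≡ true
⇔ᵇ∧⇒ᵇ⁺ true true true d refl h = h refl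
⇔ᵇ∧⇒ᵇ⁺ true true false d refl h = refl
⇔ᵇ∧⇒ᵇ⁺ false false true d refl h = h refl
⇔ᵇ∧⇒ᵇ⁺ false false false d refl h = refl

not-𝕁 : ∀ λ' j → not (𝕁 λ' j) ≡ not (j ∈ᵇ properPartialSums (dual λ'))
not-𝕁 λ' j = cong not (not-involutive (j ∈ᵇ properPartialSums (dual λ')))

not-Jpart : ∀ μ j → not (Jpart μ j) ≡ (j ∈ᵇ properPartialSums μ)
not-Jpart μ j = not-involutive (j ∈ᵇ properPartialSums μ)

descentTest⁻ : ∀ m λ' μ L → length L ≡ m → T (descentTest m (𝕁 λ') (Jpart μ) L) →
  LeftDescentsOf m λ' L × RightDescentsIn μ L
descentTest⁻ m λ' μ L len t = left , right
  where
  at : ∀ j → 1 ≤ j → suc j ≤ m → _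
  at j p q = ⇔ᵇ∧⇒ᵇ⁻ (leftDescent L j) (not (𝕁 λ' j)) (rightDescent L j) (not (Jpart μ j)) (all-simpleIdx⁻ _ m t j p q)
  left : LeftDescentsOf m λ' L
  left j p q = trans (proj₁ (at j p q)) (not-𝕁 λ' j)
  right : RightDescentsIn μ L
  right j p q desc = trans (sym (not-Jpart μ j)) (proj₂ (at j p (subst (suc j ≤_) len q)) desc)

descentTest⁺ : ∀ m λ' μ L → length L ≡ m → LeftDescentsOf m λ' L → RightDescentsIn μ L →
  T (descentTest m (𝕁 λ') (Jpart μ) L)
descentTest⁺ m λ' μ L len left right = all-simpleIdx⁺ _ m λ j p q →
  ⇔ᵇ∧⇒ᵇ⁺ (leftDescent L j) (not (𝕁 λ' j)) (rightDescent L j) (not (Jpart μ j))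
    (trans (left j p q) (sym (not-𝕁 λ' j)))
    (λ desc → trans (not-Jpart μ j) (right j p (subst (suc j ≤_) (sym len) q) desc))

value : ∀ {m} → Fin m → ℕ
value v = suc (toℕ v)

value-injective : ∀ {m} {a b : Fin m} → value a ≡ value b → a ≡ b
value-injective e = toℕ-injective (suc-injective e)

T-not⁻ : ∀ {b} → T (not b) → T b → ⊥
T-not⁻ {false} _ ()

T-not⁺ : ∀ {b} → (T b → ⊥) → T (not b)
T-not⁺ {false} _ = tt
T-not⁺ {true} ¬b = ¬b tt

distinctᵇ⁻ : ∀ {m} (xs : List (Fin m)) → T (distinctᵇ xs) → Distinct xs
distinctᵇ⁻ [] _ = []ᵈ
distinctᵇ⁻ (x ∷ xs) t = x∉ ∷ᵈ distinctᵇ⁻ xs (T-∧₂ {not (any (λ y → ⌊ x ≟ᶠ y ⌋) xs)} t)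
  where
  x∉ : x ∉ xs
  x∉ m = T-not⁻ (T-∧₁ t) (any⁺ _ (Any.map fromWitness m))

distinctᵇ⁺ : ∀ {m} (xs : List (Fin m)) → Distinct xs → T (distinctᵇ xs)
distinctᵇ⁺ [] _ = tt
distinctᵇ⁺ (x ∷ xs) (x∉ ∷ᵈ d) = T-∧⁺ (T-not⁺ (x∉ ∘ Any.map toWitness ∘ any⁻ _ xs)) (distinctᵇ⁺ xs d)

𝒟⇒admissible : ∀ m λ' μ (d : 𝒟 m (𝕁 λ') (Jpart μ)) → Admissible m λ' μ (values (proj₁ d))
𝒟⇒admissible m λ' μ (w , perm , desc) =
  let (left , right) = descentTest⁻ m λ' μ (values w) len desc in
  (len , map-distinct value (λ _ _ → value-injective) (distinctᵇ⁻ (toList w) perm) , range) , left , right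
  where
  len : length (values w) ≡ m
  len = trans (length-map value (toList w)) (length-toList w)
  range : ∀ {x} → x ∈ values w → 1 ≤ x × x ≤ m
  range m with ∈-map⁻ value m
  ... | v , _ , refl = s≤s z≤n , toℕ<n v

fromValues : ∀ {m} (L : List ℕ) → (∀ {x} → x ∈ L → 1 ≤ x × x ≤ m) → Vec (Fin m) (length L)
fromValues [] range = []ᵛ
fromValues {m} (x ∷ L) range = fromℕ< x-1<m ∷ᵛ fromValues L (range ∘ there)
  where
  x-1<m : x ∸ 1 < m
  x-1<m = let (1≤x , x≤m) = range (here refl) in subst (_≤ m) (sym (suc[n∸1]≡n 1≤x)) x≤m

values-fromValues : ∀ {m} L (range : ∀ {x} → x ∈ L → 1 ≤ x × x ≤ m) → map value (toList (fromValues {m} L range)) ≡ L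
values-fromValues [] range = refl
values-fromValues (x ∷ L) range =
  cong₂ _∷_ (trans (cong suc (toℕ-fromℕ< _)) (suc[n∸1]≡n (proj₁ (range (here refl))))) (values-fromValues L (range ∘ there))

toList-subst : ∀ {A : Set} {a b} (e : a ≡ b) (v : Vec A a) → toList (subst (Vec A) e v) ≡ toList v
toList-subst refl v = refl

admissible⇒𝒟 : ∀ m λ' μ L → Admissible m λ' μ L → Σ (𝒟 m (𝕁 λ') (Jpart μ)) λ d → values (proj₁ d) ≡ L
admissible⇒𝒟 m λ' μ L ((len , dist , range) , left , right) = (w , perm , desc) , values-w
  where
  w : Word m
  w = subst (Vec (Fin m)) len (fromValues L range)
  values-w : values w ≡ L
  values-w = trans (cong (map value) (toList-subst len (fromValues L range))) (values-fromValues L range)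
  perm : T (isPermᵇ w)
  perm = distinctᵇ⁺ (toList w) (map-distinct⁻ value (subst Distinct (sym values-w) dist))
  desc : T (descCondᵇ m (𝕁 λ') (Jpart μ) w)
  desc = descentTest⁺ m λ' μ (values w) (trans (cong length values-w) len)
    (λ j a b → trans (cong (λ z → leftDescent z j) values-w) (left j a b))
    (subst (RightDescentsIn μ) (sym values-w) right)

values-injective : ∀ {m} {w w' : Word m} → values w ≡ values w' → w ≡ w'
values-injective {w = w} {w'} e = toList-injective' w w' (map-injective value-injective e)
  where
  toList-injective' : ∀ {A : Set} {n} (v v' : Vec A n) → toList v ≡ toList v' → v ≡ v'
  toList-injective' []ᵛ []ᵛ _ = refl
  toList-injective' (a ∷ᵛ v) (b ∷ᵛ v') e = cong₂ _∷ᵛ_ (∷-injectiveˡ e) (toList-injective' v v' (∷-injectiveʳ e))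

𝒟-≡ : ∀ {m J K} {a b : 𝒟 m J K} → proj₁ a ≡ proj₁ b → a ≡ b
𝒟-≡ {a = w , p , c} {b = .w , p' , c'} refl = cong₂ (λ x y → w , x , y) (T-irrelevant p p') (T-irrelevant c c')

-- Counting.  card𝒟 filters the enumeration allVecs, which lists every word
-- exactly once; so an injection 𝒟 → 𝒟' bounds card𝒟 by card𝒟' (pigeonhole).

allVecs-complete : ∀ m k (v : Vec (Fin m) k) → v ∈ allVecs m k
allVecs-complete m zero []ᵛ = here refl
allVecs-complete m (suc k) (x ∷ᵛ v) =
  ∈-concatMap⁺ {xs = allFin m} (λ x → map (x ∷ᵛ_) (allVecs m k)) (∈-allFin x) (∈-map⁺ (x ∷ᵛ_) (allVecs-complete m k v))
  where
  ∈-concatMap⁺ : ∀ {A B : Set} {xs : List A} (f : A → List B) {x y} → x ∈ xs → y ∈ f x → y ∈ concatMap f xs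
  ∈-concatMap⁺ {xs = x ∷ xs} f (here refl) m = ∈-++⁺ˡ m
  ∈-concatMap⁺ {xs = x' ∷ xs} f (there x∈) m = ∈-++⁺ʳ (f x') (∈-concatMap⁺ {xs = xs} f x∈ m)

allVecs-distinct : ∀ m k → Distinct (allVecs m k)
allVecs-distinct m zero = (λ ()) ∷ᵈ []ᵈ
allVecs-distinct m (suc k) = prefixed (allFin m) (allFin⁺ m)
  where
  heads : ∀ F {v} → v ∈ concatMap (λ x → map (x ∷ᵛ_) (allVecs m k)) F → head v ∈ F
  heads (x ∷ F) v∈ with ∈-++⁻ (map (x ∷ᵛ_) (allVecs m k)) v∈
  ... | inj₁ v∈x with ∈-map⁻ (x ∷ᵛ_) v∈x
  ...   | _ , _ , refl = here refl
  heads (x ∷ F) v∈ | inj₂ v∈F = there (heads F v∈F)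
  prefixed : ∀ F → Unique F → Distinct (concatMap (λ x → map (x ∷ᵛ_) (allVecs m k)) F)
  prefixed [] _ = []ᵈ
  prefixed (x ∷ F) u@(_ ∷ᵖ u') =
    ++-distinct (map-distinct (x ∷ᵛ_) (λ _ _ → ∷ᵛ-injectiveʳ) (allVecs-distinct m k)) (prefixed F u') disjoint
    where
    disjoint : ∀ {v} → v ∈ map (x ∷ᵛ_) (allVecs m k) → v ∈ concatMap (λ x → map (x ∷ᵛ_) (allVecs m k)) F → ⊥
    disjoint v∈x v∈F with ∈-map⁻ (x ∷ᵛ_) v∈x
    ... | _ , _ , refl = Unique[x∷xs]⇒x∉xs u (heads F v∈F)

T∧ : ∀ {a b} → (a ∧ b) ≡ true → T a × T b
T∧ {true} {true} _ = tt , tt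

module _ (m : ℕ) (J K : Roots) where

  inD : Word m → Bool
  inD w = isPermᵇ w ∧ descCondᵇ m J K w

  members : List (Word m) → List (𝒟 m J K)
  prepend : ∀ w b → inD w ≡ b → List (𝒟 m J K) → List (𝒟 m J K)
  members [] = []
  members (w ∷ ws) = prepend w (inD w) refl (members ws)
  prepend w true e ds = (w , T∧ e) ∷ ds
  prepend w false e ds = ds

  members-words : ∀ ws → map proj₁ (members ws) ≡ filterᵇ inD ws
  members-words [] = refl
  members-words (w ∷ ws) = by-test (inD w) refl
    where
    by-test : ∀ b (e : inD w ≡ b) → map proj₁ (prepend w b e (members ws)) ≡ filterᵇ inD (w ∷ ws)
    by-test true e = trans (cong (w ∷_) (members-words ws)) (sym (filterᵇ-accept inD {w} ws e))
    by-test false e = trans (members-words ws) (sym (filterᵇ-reject inD {w} ws e))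

card-≤ : ∀ {m m' J K J' K'} (f : 𝒟 m J K → 𝒟 m' J' K') → (∀ {a b} → f a ≡ f b → a ≡ b) →
  card𝒟 m J K ≤ card𝒟 m' J' K'
card-≤ {m} {m'} {J} {K} {J'} {K'} f f-injective =
  subst (_≤ card𝒟 m' J' K') |image| (distinct-length (≡-dec _≟ᶠ_) image-distinct image⊆)
  where
  X = members m J K (allVecs m m)
  image = map (proj₁ ∘ f) X
  |image| : length image ≡ card𝒟 m J K
  |image| = trans (length-map _ X) (trans (sym (length-map proj₁ X)) (cong length (members-words m J K (allVecs m m))))
  image-distinct : Distinct image
  image-distinct = map-distinct (proj₁ ∘ f) (λ _ _ e → f-injective (𝒟-≡ e))
    (map-distinct⁻ proj₁ (subst Distinct (sym (members-words m J K (allVecs m m)))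
      (filter-distinct (inD m J K) (allVecs-distinct m m))))
  image⊆ : ∀ {y} → y ∈ image → y ∈ filterᵇ (inD m' J' K') (allVecs m' m')
  image⊆ y∈ with ∈-map⁻ (proj₁ ∘ f) y∈
  ... | d , _ , refl = let (w , perm , desc) = f d in
    ∈-filterᵇ⁺ (inD m' J' K') (allVecs m' m') (allVecs-complete m' m' w) (fromT (T-∧⁺ perm desc))

card-⤖ : ∀ {m m' J K J' K'} → 𝒟 m J K ⤖ 𝒟 m' J' K' → card𝒟 m J K ≡ card𝒟 m' J' K'
card-⤖ b = ≤-antisym (card-≤ to injective) (card-≤ from from-injective)
  where
  open Bijection b using (to; injective; surjective)
  from : _ → _
  from y = proj₁ (surjective y)
  from-injective : ∀ {a c} → from a ≡ from c → a ≡ c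
  from-injective {a} {c} e = trans (sym (proj₂ (surjective a) refl)) (trans (cong to e) (proj₂ (surjective c) refl))

card-empty : ∀ m J K → ¬ 𝒟 m J K → card𝒟 m J K ≡ 0
card-empty m J K empty = cong length (filterᵇ-none (inD m J K) (allVecs m m)
  (λ {w} _ → bool-false _ (λ e → empty (w , T∧ e))))

small : ℕ → ℕ → Bool
small k x = x ≤ᵇ k

large : ℕ → ℕ → Bool
large k x = k <ᵇ x

large≡not-small : ∀ k x → large k x ≡ not (small k x)
large≡not-small k x with k <? x
... | yes k<x rewrite <ᵇ-intro k<x | ≤ᵇ-false k<x = refl
... | no k≮x rewrite <ᵇ-false {k} {x} (≮⇒≥ k≮x) | ≤ᵇ-intro {x} {k} (≮⇒≥ k≮x) = refl

forced-countdown : ∀ k M → Distinct M → (∀ {x} → x ∈ M → 1 ≤ x × x ≤ k) → (∀ v → 1 ≤ v → v ≤ k → v ∈ M) →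
  (∀ j → 1 ≤ j → j < k → (pos M (suc j) <ᵇ pos M j) ≡ true) → M ≡ countdown k
forced-countdown zero [] _ _ _ _ = refl
forced-countdown zero (x ∷ M) _ range _ _ = let (1≤x , x≤0) = range (here refl) in ⊥-elim (1+n≰n (≤-trans 1≤x x≤0))
forced-countdown (suc k) [] _ _ complete _ = case complete 1 (s≤s z≤n) (s≤s z≤n) of λ ()
forced-countdown (suc k) (x ∷ M) (x∉ ∷ᵈ d) range complete desc =
  cong₂ _∷_ x≡k+1 (forced-countdown k M d range' complete' desc')
  where
  -- x comes first, so x+1 (if ≤ k+1) would have to come before position 1.
  x≡k+1 : x ≡ suc k
  x≡k+1 with x ≟ suc k
  ... | yes e = e
  ... | no x≢ = ⊥-elim (before-head (desc x (proj₁ (range (here refl))) x<k+1))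
    where
    x<k+1 : x < suc k
    x<k+1 = ≤∧≢⇒< (proj₂ (range (here refl))) x≢
    before-head : (pos (x ∷ M) (suc x) <ᵇ pos (x ∷ M) x) ≡ true → ⊥
    before-head e with pos (x ∷ M) (suc x) | pos-present (x ∷ M) (complete (suc x) (s≤s z≤n) x<k+1)
    ... | suc p | _ rewrite pos-head x M = t≢f (trans (sym e) (<ᵇ-false {suc p} {1} (s≤s z≤n)))
  ≢x : ∀ {v} → v ≤ k → v ≢ x
  ≢x v≤k refl = 1+n≰n (subst (_≤ k) x≡k+1 v≤k)
  range' : ∀ {y} → y ∈ M → 1 ≤ y × y ≤ k
  range' {y} y∈ = let (1≤y , y≤k+1) = range (there y∈) in
    1≤y , ≤-pred (≤∧≢⇒< y≤k+1 (λ e → x∉ (subst (_∈ M) (trans e (sym x≡k+1)) y∈)))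
  complete' : ∀ v → 1 ≤ v → v ≤ k → v ∈ M
  complete' v 1≤v v≤k with complete v 1≤v (m≤n⇒m≤1+n v≤k)
  ... | here e = ⊥-elim (≢x v≤k e)
  ... | there v∈ = v∈
  desc' : ∀ j → 1 ≤ j → j < k → (pos M (suc j) <ᵇ pos M j) ≡ true
  desc' j 1≤j j<k = begin
    pos M (suc j) <ᵇ pos M j                                   ≡⟨ proj₂ (proj₂ (pos-skip-order {P} {Q} {P} {Q} (refl , refl , refl))) ⟩
    pos-step false P <ᵇ pos-step false Q                       ≡⟨ sym (cong₂ _<ᵇ_ (pos-other x M (≢x j<k)) (pos-other x M (≢x (<⇒≤ j<k)))) ⟩
    pos (x ∷ M) (suc j) <ᵇ pos (x ∷ M) j                       ≡⟨ desc j 1≤j (m≤n⇒m≤1+n j<k) ⟩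
    true ∎
    where
    open ≡-Reasoning
    P = pos M (suc j)
    Q = pos M j

AllSorted : List (List ℕ) → Set
AllSorted Ps = ∀ {P} → P ∈ Ps → Sorted P

countdown-pieces : ∀ k Ps → concat Ps ≡ countdown k → AllSorted Ps → k ≤ length Ps
countdown-pieces zero Ps e s = z≤n
countdown-pieces (suc k) [] () s
countdown-pieces (suc k) ([] ∷ Ps) e s = m≤n⇒m≤1+n (countdown-pieces (suc k) Ps e (s ∘ there))
countdown-pieces (suc k) ((a ∷ []) ∷ Ps) e s = s≤s (countdown-pieces k Ps (∷-injectiveʳ e) (s ∘ there))
countdown-pieces (suc zero) ((a ∷ b ∷ P) ∷ Ps) () s
countdown-pieces (suc (suc k)) ((a ∷ b ∷ P) ∷ Ps) e s with s (here refl)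
... | a≤ ∷ˢ _ = ⊥-elim (1+n≰n (subst₂ _≤_ (∷-injectiveˡ e) (∷-injectiveˡ (∷-injectiveʳ e)) (a≤ (here refl))))

countdown-singletons : ∀ k Ps → concat Ps ≡ countdown k → AllSorted Ps → length Ps ≡ k →
  Ps ≡ map (_∷ []) (countdown k)
countdown-singletons zero [] e s l = refl
countdown-singletons (suc k) ([] ∷ Ps) e s l =
  ⊥-elim (1+n≰n (subst (_≤ length Ps) (sym l) (countdown-pieces (suc k) Ps e (s ∘ there))))
countdown-singletons (suc k) ((a ∷ []) ∷ Ps) e s l =
  cong₂ _∷_ (cong (_∷ []) (∷-injectiveˡ e)) (countdown-singletons k Ps (∷-injectiveʳ e) (s ∘ there) (suc-injective l))
countdown-singletons (suc zero) ((a ∷ b ∷ P) ∷ Ps) () s l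
countdown-singletons (suc (suc k)) ((a ∷ b ∷ P) ∷ Ps) e s l with s (here refl)
... | a≤ ∷ˢ _ = ⊥-elim (1+n≰n (subst₂ _≤_ (∷-injectiveˡ e) (∷-injectiveˡ (∷-injectiveʳ e)) (a≤ (here refl))))

block-head : ∀ k h B → Sorted B → filterᵇ (small k) B ≡ h ∷ [] → B ≡ h ∷ filterᵇ (large k) B
block-head k h [] sB ()
block-head k h (x ∷ B) (x≤ ∷ˢ sB) e with small k x in sx
... | true = cong₂ _∷_ (∷-injectiveˡ e) (sym (trans
  (filterᵇ-reject (large k) {x} B (trans (large≡not-small k x) (cong not sx)))
  (filterᵇ-all (large k) B (λ {y} y∈ → trans (large≡not-small k y) (cong not (filterᵇ-[] (small k) B (∷-injectiveʳ e) y∈))))))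
... | false = ⊥-elim (<⇒≱ (≤ᵇ-false⁻ sx) (≤-trans (x≤ (proj₁ h∈)) (≤ᵇ-true (proj₂ h∈))))
  where
  h∈ : h ∈ B × small k h ≡ true
  h∈ = ∈-filterᵇ⁻ (small k) B (subst (h ∈_) (sym e) (here refl))

blocks-headed-by-countdown : ∀ k Bs → length Bs ≡ k → AllSorted Bs → filterᵇ (small k) (concat Bs) ≡ countdown k →
  Bs ≡ zipWith _∷_ (countdown k) (map (filterᵇ (large k)) Bs)
blocks-headed-by-countdown k Bs len s e = heads Bs (countdown k)
  (countdown-singletons k (map (filterᵇ (small k)) Bs) (trans (sym (filterᵇ-concat (small k) Bs)) e)
    (smallParts-sorted Bs s) (trans (length-map _ Bs) len)) s
  where
  smallParts-sorted : ∀ Bs → AllSorted Bs → AllSorted (map (filterᵇ (small k)) Bs)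
  smallParts-sorted (B ∷ Bs) s (here refl) = sorted-filter (small k) (s (here refl))
  smallParts-sorted (B ∷ Bs) s (there m) = smallParts-sorted Bs (s ∘ there) m
  heads : ∀ Bs hs → map (filterᵇ (small k)) Bs ≡ map (_∷ []) hs → AllSorted Bs →
    Bs ≡ zipWith _∷_ hs (map (filterᵇ (large k)) Bs)
  heads [] [] e s = refl
  heads (B ∷ Bs) (h ∷ hs) e s =
    cong₂ _∷_ (block-head k h B (s (here refl)) (∷-injectiveˡ e)) (heads Bs hs (∷-injectiveʳ e) (s ∘ there))

countdown-needs-k-blocks : ∀ k Bs → length Bs < k → AllSorted Bs → filterᵇ (small k) (concat Bs) ≡ countdown k → ⊥
countdown-needs-k-blocks k Bs lt s e = <⇒≱ lt (subst (k ≤_) (length-map _ Bs)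
  (countdown-pieces k (map (filterᵇ (small k)) Bs) (trans (sym (filterᵇ-concat (small k) Bs)) e) smallParts-sorted))
  where
  smallParts-sorted : AllSorted (map (filterᵇ (small k)) Bs)
  smallParts-sorted m with ∈-map⁻ (filterᵇ (small k)) m
  ... | B , B∈ , refl = sorted-filter (small k) (s B∈)

peel : ℕ → List ℕ → List ℕ
peel k L = map (_∸ k) (filterᵇ (large k) L)

peel-concat : ∀ k Bs → peel k (concat Bs) ≡ concat (map (peel k) Bs)
peel-concat k [] = refl
peel-concat k (B ∷ Bs) = trans (cong (map (_∸ k)) (filter-++ (T? ∘ large k) B (concat Bs)))
  (trans (map-++ (_∸ k) (filterᵇ (large k) B) _) (cong (peel k B ++_) (peel-concat k Bs)))

large-values : ∀ k L → ∀ {x} → x ∈ filterᵇ (large k) L → k < x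
large-values k L m = <ᵇ-true (proj₂ (∈-filterᵇ⁻ (large k) L m))

blocks-peel : ∀ k {s Bs} hs → Blocks s Bs → Bs ≡ zipWith _∷_ hs (map (filterᵇ (large k)) Bs) →
  Blocks (map (_∸ 1) s) (map (peel k) Bs)
blocks-peel k hs []ᵇ e = []ᵇ
blocks-peel k [] (block _ _ _) ()
blocks-peel k (h ∷ hs) (block {x} {s} {B} {Bs} |B| sB b) e =
  block |peel| (sorted-map (_∸ k) (∸-monoˡ-≤ k) (sorted-filter (large k) sB)) (blocks-peel k hs b (∷-injectiveʳ e))
  where
  |peel| : length (peel k B) ≡ x ∸ 1
  |peel| = trans (length-map (_∸ k) (filterᵇ (large k) B)) (cong (_∸ 1) (trans (sym (cong length (∷-injectiveˡ e))) |B|))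

reattach : ℕ → List ℕ → List (List ℕ) → List (List ℕ)
reattach k hs Cs = zipWith _∷_ hs (map (map (_+ k)) Cs)

-- The inverse of peeling, for right-descent data μ: cut into blocks of sizes
-- μᵢ - 1 and reattach the countdown.
unpeel : ℕ → List ℕ → List ℕ → List ℕ
unpeel k s L' = concat (reattach k (countdown k) (splitBy s L'))

raised-large : ∀ k C → AllPositive C → ∀ {z} → z ∈ map (_+ k) C → large k z ≡ true
raised-large k C pos m with ∈-map⁻ (_+ k) m
... | y , y∈ , refl = <ᵇ-intro (+-monoˡ-≤ k (pos y∈))

module Reattach (k : ℕ) where

  record Fits (hs : List ℕ) (Cs : List (List ℕ)) : Set where
    field
      lengths : length hs ≡ length Cs
      heads-small : ∀ {h} → h ∈ hs → h ≤ k
      blocks-positive : ∀ {C} → C ∈ Cs → AllPositive C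

  fits-tail : ∀ {h hs C Cs} → Fits (h ∷ hs) (C ∷ Cs) → Fits hs Cs
  fits-tail f = record
    { lengths = suc-injective (Fits.lengths f)
    ; heads-small = Fits.heads-small f ∘ there
    ; blocks-positive = Fits.blocks-positive f ∘ there }

  reattach-small : ∀ hs Cs → Fits hs Cs → filterᵇ (small k) (concat (reattach k hs Cs)) ≡ hs
  reattach-small [] [] _ = refl
  reattach-small (h ∷ hs) (C ∷ Cs) f =
    trans (filterᵇ-accept (small k) {h} _ (≤ᵇ-intro (Fits.heads-small f (here refl))))
      (cong (h ∷_) (trans (filter-++ (T? ∘ small k) (map (_+ k) C) _)
        (cong₂ _++_ (filterᵇ-none (small k) (map (_+ k) C) not-small) (reattach-small hs Cs (fits-tail f)))))
    where
    not-small : ∀ {z} → z ∈ map (_+ k) C → small k z ≡ false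
    not-small {z} m = trans (sym (not-involutive (small k z)))
      (cong not (trans (sym (large≡not-small k z)) (raised-large k C (Fits.blocks-positive f (here refl)) m)))

  reattach-large : ∀ hs Cs → Fits hs Cs → filterᵇ (large k) (concat (reattach k hs Cs)) ≡ map (_+ k) (concat Cs)
  reattach-large [] [] _ = refl
  reattach-large (h ∷ hs) (C ∷ Cs) f =
    trans (filterᵇ-reject (large k) {h} _ (trans (large≡not-small k h) (cong not (≤ᵇ-intro (Fits.heads-small f (here refl))))))
      (trans (filter-++ (T? ∘ large k) (map (_+ k) C) _)
        (trans (cong₂ _++_ (filterᵇ-all (large k) (map (_+ k) C) (raised-large k C (Fits.blocks-positive f (here refl))))
                           (reattach-large hs Cs (fits-tail f)))
          (sym (map-++ (_+ k) C (concat Cs)))))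

  blocks-reattach : ∀ μ hs Cs → AllPositive μ → Blocks (map (_∸ 1) μ) Cs → Fits hs Cs → Blocks μ (reattach k hs Cs)
  blocks-reattach [] [] [] _ []ᵇ _ = []ᵇ
  blocks-reattach (x ∷ μ) (h ∷ hs) (C ∷ Cs) pos (block |C| sC b) f =
    block |hC| (h≤ ∷ˢ sorted-map (_+ k) (+-monoˡ-≤ k) sC) (blocks-reattach μ hs Cs (pos ∘ there) b (fits-tail f))
    where
    |hC| : suc (length (map (_+ k) C)) ≡ x
    |hC| = trans (cong suc (trans (length-map _ C) |C|)) (suc[n∸1]≡n (pos (here refl)))
    h≤ : ∀ {z} → z ∈ map (_+ k) C → h ≤ z
    h≤ m with ∈-map⁻ (_+ k) m
    ... | y , _ , refl = ≤-trans (Fits.heads-small f (here refl)) (m≤n+m k y)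

  peel-reattach : ∀ hs Cs → Fits hs Cs → peel k (concat (reattach k hs Cs)) ≡ concat Cs
  peel-reattach hs Cs f = trans (cong (map (_∸ k)) (reattach-large hs Cs f)) (lower-raise (concat Cs))
    where
    lower-raise : ∀ L → map (_∸ k) (map (_+ k) L) ≡ L
    lower-raise [] = refl
    lower-raise (y ∷ L) = cong₂ _∷_ (m+n∸n≡m y k) (lower-raise L)

raise-peel : ∀ k Bs → map (map (_+ k)) (map (peel k) Bs) ≡ map (filterᵇ (large k)) Bs
raise-peel k [] = refl
raise-peel k (B ∷ Bs) = cong₂ _∷_ (raise-lower (filterᵇ (large k) B) (large-values k B)) (raise-peel k Bs)
  where
  raise-lower : ∀ M → (∀ {x} → x ∈ M → k < x) → map (_+ k) (map (_∸ k) M) ≡ M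
  raise-lower [] h = refl
  raise-lower (x ∷ M) h = cong₂ _∷_ (m∸n+n≡m (<⇒≤ (h (here refl)))) (raise-lower M (h ∘ there))

leftDescent-peel : ∀ k L j → 1 ≤ j → leftDescent (peel k L) j ≡ leftDescent L (j + k)
leftDescent-peel k L j 1≤j
  rewrite pos-map-∸ k (filterᵇ (large k) L) (large-values k L) (suc j)
        | pos-map-∸ k (filterᵇ (large k) L) (large-values k L) j =
  proj₂ (proj₂ (pos-filter-order (large k) {suc j + k} {j + k} (<ᵇ-intro (s≤s (m≤n+m k j))) (<ᵇ-intro (+-monoˡ-≤ k 1≤j)) L))

pos-countdown : ∀ k v → 1 ≤ v → v ≤ k → pos (countdown k) v ≡ suc (k ∸ v)
pos-countdown zero (suc v) _ ()
pos-countdown (suc k) v 1≤v v≤k+1 with v ≟ suc k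
... | yes refl = trans (pos-head (suc k) (countdown k)) (cong suc (sym (n∸n≡0 k)))
... | no v≢ = trans (pos-other (suc k) (countdown k) v≢)
  (trans (cong (pos-step false) (pos-countdown k v 1≤v v≤k)) (cong suc (sym (+-∸-assoc 1 v≤k))))
  where
  v≤k : v ≤ k
  v≤k = ≤-pred (≤∧≢⇒< v≤k+1 v≢)

leftDescent-countdown : ∀ k j → 1 ≤ j → j < k → leftDescent (countdown k) j ≡ true
leftDescent-countdown k j 1≤j j<k
  rewrite pos-countdown k (suc j) (s≤s z≤n) j<k | pos-countdown k j 1≤j (<⇒≤ j<k) | +-∸-assoc 1 {k} {suc j} j<k =
  <ᵇ-intro {k ∸ suc j} {suc (k ∸ suc j)} ≤-refl

reattach-countdown-head : ∀ k Cs → 1 ≤ k → length Cs ≡ k →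
  Σ (List ℕ) λ rest → concat (reattach k (countdown k) Cs) ≡ k ∷ rest
reattach-countdown-head (suc k) (C ∷ Cs) _ _ = _ , refl

no-leftDescent-at-head : ∀ k rest → suc k ∈ (k ∷ rest) → leftDescent (k ∷ rest) k ≡ false
no-leftDescent-at-head k rest k+1∈ rewrite pos-head k rest
  with pos (k ∷ rest) (suc k) | pos-present (k ∷ rest) k+1∈
... | suc p | _ = refl

dual-of-rows : ∀ {n k} λ' → IsPartition n λ' → length λ' ≡ k → 1 ≤ k → dual λ' ≡ k ∷ dual (cut 1 λ')
dual-of-rows (x ∷ xs) pλ refl _ = dual-first-column x xs (proj₁ pλ) (partition-positive pλ)

module Rows (n k : ℕ) (λ' : List ℕ) (pλ : IsPartition n λ') (lλ : length λ' ≡ k) (k≥1 : 1 ≤ k) where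

  k≤n : k ≤ n
  k≤n = subst₂ _≤_ lλ (proj₂ (proj₂ pλ)) (length≤sum λ' (partition-positive pλ))

  dual-λ : dual λ' ≡ k ∷ dual (cut 1 λ')
  dual-λ = dual-of-rows λ' pλ lλ k≥1

  sum-cut-λ : sum (cut 1 λ') ≡ n ∸ k
  sum-cut-λ = trans (sum-cut 1 λ' (partition-positive pλ)) (cong₂ _∸_ (proj₂ (proj₂ pλ)) (trans (*-identityʳ _) lλ))

  not-descent-below : ∀ j → j < k → (j ∈ᵇ properPartialSums (dual λ')) ≡ false
  not-descent-below j j<k rewrite dual-λ = partialSum-below k (dual (cut 1 λ')) j j<k

  descent-above : ∀ i → ((k + suc i) ∈ᵇ properPartialSums (dual λ')) ≡ (suc i ∈ᵇ properPartialSums (dual (cut 1 λ')))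
  descent-above i rewrite dual-λ = partialSum-above k (dual (cut 1 λ')) i

  descent-at : k < n → (k ∈ᵇ properPartialSums (dual λ')) ≡ true
  descent-at k<n with dual-nonempty (cut 1 λ') (cut-positive 1 λ') cut≢[]
    where
    cut≢[] : cut 1 λ' ≢ []
    cut≢[] e = <⇒≢ (m<n⇒0<n∸m k<n) (sym (trans (sym sum-cut-λ) (cong sum e)))
  ... | d , ds , e rewrite dual-λ | e = partialSum-first k d ds

  countdown-in : ∀ μ L → Admissible n λ' μ L → filterᵇ (small k) L ≡ countdown k
  countdown-in μ L (perm@(len , d , range) , left , right) =
    forced-countdown k (filterᵇ (small k) L) (filter-distinct (small k) d) range' complete desc
    where
    range' : ∀ {x} → x ∈ filterᵇ (small k) L → 1 ≤ x × x ≤ k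
    range' m = let (x∈ , sx) = ∈-filterᵇ⁻ (small k) L m in proj₁ (range x∈) , ≤ᵇ-true sx
    complete : ∀ v → 1 ≤ v → v ≤ k → v ∈ filterᵇ (small k) L
    complete v 1≤v v≤k = ∈-filterᵇ⁺ (small k) L (permList-complete perm v 1≤v (≤-trans v≤k k≤n)) (≤ᵇ-intro v≤k)
    desc : ∀ j → 1 ≤ j → j < k → leftDescent (filterᵇ (small k) L) j ≡ true
    desc j 1≤j j<k = trans (proj₂ (proj₂ (pos-filter-order (small k) {suc j} {j} (≤ᵇ-intro j<k) (≤ᵇ-intro (<⇒≤ j<k)) L)))
      (trans (left j 1≤j (≤-trans j<k k≤n)) (cong not (not-descent-below j j<k)))

  blocks-of : ∀ μ L → sum μ ≡ n → Admissible n λ' μ L → Blocks μ (splitBy μ L) × concat (splitBy μ L) ≡ L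
  blocks-of μ L sμ ((len , _) , _ , right) = rightDescents⇒blocks μ L (trans len (sym sμ)) right

  no-admissible-with-fewer-parts : ∀ μ L → sum μ ≡ n → length μ < k → ¬ Admissible n λ' μ L
  no-admissible-with-fewer-parts μ L sμ short g =
    let (b , concat≡L) = blocks-of μ L sμ g in
    countdown-needs-k-blocks k (splitBy μ L) (subst (_< k) (sym (blocks-length b)) short) (blocks-sorted b)
      (trans (cong (filterᵇ (small k)) concat≡L) (countdown-in μ L g))

module PeelStep (n k : ℕ) (λ' μ : List ℕ) (pλ : IsPartition n λ') (lλ : length λ' ≡ k)
                (pμ : IsPartition n μ) (lμ : length μ ≡ k) (k≥1 : 1 ≤ k) where

  open Rows n k λ' pλ lλ k≥1

  -- Sizes of the μ-blocks once their heads are removed.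
  s : List ℕ
  s = map (_∸ 1) μ

  n' : ℕ
  n' = n ∸ k

  sum-cut-μ : sum (cut 1 μ) ≡ n'
  sum-cut-μ = trans (sum-cut 1 μ (partition-positive pμ)) (cong₂ _∸_ (proj₂ (proj₂ pμ)) (trans (*-identityʳ _) lμ))

  shift-bound : ∀ {a} → suc a ≤ n' → suc (a + k) ≤ n
  shift-bound {a} q = subst (suc (a + k) ≤_) (m∸n+n≡m k≤n) (+-monoˡ-≤ k q)

  module Forward (L : List ℕ) (g : Admissible n λ' μ L) where

    private
      perm = proj₁ g
      Bs = splitBy μ L
      blocks = proj₁ (blocks-of μ L (proj₂ (proj₂ pμ)) g)
      concat≡L = proj₂ (blocks-of μ L (proj₂ (proj₂ pμ)) g)

      headed : Bs ≡ zipWith _∷_ (countdown k) (map (filterᵇ (large k)) Bs)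
      headed = blocks-headed-by-countdown k Bs (trans (blocks-length blocks) lμ) (blocks-sorted blocks)
        (trans (cong (filterᵇ (small k)) concat≡L) (countdown-in μ L g))

      peeled-blocks : Blocks s (map (peel k) Bs)
      peeled-blocks = blocks-peel k (countdown k) blocks headed

      peel≡concat : peel k L ≡ concat (map (peel k) Bs)
      peel≡concat = trans (cong (peel k) (sym concat≡L)) (peel-concat k Bs)

      length-peel : length (peel k L) ≡ n'
      length-peel = trans (length-map (_∸ k) (filterᵇ (large k) L)) (sym (begin
        n ∸ k                                                     ≡⟨ cong (_∸ k) (sym (proj₁ perm)) ⟩
        length L ∸ k                                              ≡⟨ cong (_∸ k) (length-filterᵇ-split (small k) (large k) (large≡not-small k) L) ⟩
        length (filterᵇ (small k) L) + length (filterᵇ (large k) L) ∸ k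
          ≡⟨ cong (λ z → length z + length (filterᵇ (large k) L) ∸ k) (countdown-in μ L g) ⟩
        length (countdown k) + length (filterᵇ (large k) L) ∸ k   ≡⟨ cong (λ z → z + length (filterᵇ (large k) L) ∸ k) (length-countdown k) ⟩
        k + length (filterᵇ (large k) L) ∸ k                      ≡⟨ m+n∸m≡n k _ ⟩
        length (filterᵇ (large k) L) ∎))
        where open ≡-Reasoning

      distinct-peel : Distinct (peel k L)
      distinct-peel = map-distinct (_∸ k) lower-injective (filter-distinct (large k) (proj₁ (proj₂ perm)))
        where
        lower-injective : ∀ {x y} → x ∈ filterᵇ (large k) L → y ∈ filterᵇ (large k) L → x ∸ k ≡ y ∸ k → x ≡ y
        lower-injective {x} {y} x∈ y∈ e = trans (sym (m∸n+n≡m (<⇒≤ (large-values k L x∈))))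
          (trans (cong (_+ k) e) (m∸n+n≡m (<⇒≤ (large-values k L y∈))))

      range-peel : ∀ {z} → z ∈ peel k L → 1 ≤ z × z ≤ n'
      range-peel m with ∈-map⁻ (_∸ k) m
      ... | y , y∈ , refl = let (y∈L , y>k) = ∈-filterᵇ⁻ (large k) L y∈ in
        subst (_≤ y ∸ k) (m+n∸n≡m 1 k) (∸-monoˡ-≤ k (<ᵇ-true y>k)) , ∸-monoˡ-≤ k (proj₂ (proj₂ (proj₂ perm) y∈L))

      left-peel : LeftDescentsOf n' (cut 1 λ') (peel k L)
      left-peel (suc i) 1≤j bound = trans (leftDescent-peel k L (suc i) 1≤j)
        (trans (proj₁ (proj₂ g) (suc i + k) (≤-trans 1≤j (m≤m+n (suc i) k)) (shift-bound bound))
          (cong not (trans (cong (_∈ᵇ properPartialSums (dual λ')) (+-comm (suc i) k)) (descent-above i))))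

      right-peel : RightDescentsIn (cut 1 μ) (peel k L)
      right-peel = let (Bs' , blocks' , same) = blocks-dropEmpty peeled-blocks in
        subst (RightDescentsIn (cut 1 μ)) (trans same (sym peel≡concat)) (blocks⇒rightDescents blocks')

    peel-admissible : Admissible n' (cut 1 λ') (cut 1 μ) (peel k L)
    peel-admissible = (length-peel , distinct-peel , range-peel) , left-peel , right-peel

    unpeel-peel : unpeel k s (peel k L) ≡ L
    unpeel-peel = begin
      concat (reattach k (countdown k) (splitBy s (peel k L)))   ≡⟨ cong (λ z → concat (reattach k (countdown k) (splitBy s z))) peel≡concat ⟩
      concat (reattach k (countdown k) (splitBy s (concat (map (peel k) Bs))))
        ≡⟨ cong (concat ∘ reattach k (countdown k)) (splitBy-blocks peeled-blocks) ⟩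
      concat (reattach k (countdown k) (map (peel k) Bs))      ≡⟨ cong (concat ∘ zipWith _∷_ (countdown k)) (raise-peel k Bs) ⟩
      concat (zipWith _∷_ (countdown k) (map (filterᵇ (large k)) Bs)) ≡⟨ cong concat (sym headed) ⟩
      concat Bs                                                 ≡⟨ concat≡L ⟩
      L ∎
      where open ≡-Reasoning

  module Backward (L' : List ℕ) (g' : Admissible n' (cut 1 λ') (cut 1 μ) L') where

    private
      perm' = proj₁ g'
      nonempty-blocks = rightDescents⇒blocks (cut 1 μ) L' (trans (proj₁ perm') (sym sum-cut-μ)) (proj₂ (proj₂ g'))
      with-empty = blocks-addEmpty s (proj₁ nonempty-blocks)
      Cs = proj₁ with-empty

      blocks : Blocks s Cs
      blocks = proj₁ (proj₂ with-empty)

      concat≡L' : concat Cs ≡ L'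
      concat≡L' = trans (proj₂ (proj₂ with-empty)) (proj₂ nonempty-blocks)

      L = concat (reattach k (countdown k) Cs)

      unpeel≡L : unpeel k s L' ≡ L
      unpeel≡L = cong (concat ∘ reattach k (countdown k)) (trans (cong (splitBy s) (sym concat≡L')) (splitBy-blocks blocks))

      length-Cs : length Cs ≡ k
      length-Cs = trans (blocks-length blocks) (trans (length-map _ μ) lμ)

      fits : Reattach.Fits k (countdown k) Cs
      fits = record
        { lengths = trans (length-countdown k) (sym length-Cs)
        ; heads-small = proj₂ ∘ ∈-countdown⁻ k
        ; blocks-positive = λ C∈ y∈ → proj₁ (proj₂ (proj₂ perm') (subst (_ ∈_) concat≡L' (∈-concat⁺′ y∈ C∈))) }

      small-L : filterᵇ (small k) L ≡ countdown k
      small-L = Reattach.reattach-small k (countdown k) Cs fits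

      large-L : filterᵇ (large k) L ≡ map (_+ k) L'
      large-L = trans (Reattach.reattach-large k (countdown k) Cs fits) (cong (map (_+ k)) concat≡L')

      peel-L : peel k L ≡ L'
      peel-L = trans (Reattach.peel-reattach k (countdown k) Cs fits) concat≡L'

      length-L : length L ≡ n
      length-L = trans (length-filterᵇ-split (small k) (large k) (large≡not-small k) L)
        (trans (cong₂ _+_ (trans (cong length small-L) (length-countdown k))
                          (trans (cong length large-L) (trans (length-map _ L') (proj₁ perm'))))
          (m+[n∸m]≡n k≤n))

      distinct-L : Distinct L
      distinct-L = split-distinct (small k) (large k) (large≡not-small k) L
        (subst Distinct (sym small-L) (countdown-distinct k))
        (subst Distinct (sym large-L) (map-distinct (_+ k) (λ _ _ → +-cancelʳ-≡ _ _ _) (proj₁ (proj₂ perm'))))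

      range-L : ∀ {x} → x ∈ L → 1 ≤ x × x ≤ n
      range-L {x} x∈ with small k x in sx
      ... | true = let (1≤x , x≤k) = ∈-countdown⁻ k (subst (x ∈_) small-L (∈-filterᵇ⁺ (small k) L x∈ sx)) in
        1≤x , ≤-trans x≤k k≤n
      ... | false with ∈-map⁻ (_+ k) (subst (x ∈_) large-L (∈-filterᵇ⁺ (large k) L x∈ (trans (large≡not-small k x) (cong not sx))))
      ...   | y , y∈ , refl = let (1≤y , y≤n') = proj₂ (proj₂ perm') y∈ in
        ≤-trans 1≤y (m≤m+n y k) , subst (y + k ≤_) (m∸n+n≡m k≤n) (+-monoˡ-≤ k y≤n')

      perm-L : IsPermList n L
      perm-L = length-L , distinct-L , range-L

      -- Left descents: below k from the countdown, none at k (k comes first),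
      -- above k from L'.
      left-L : LeftDescentsOf n λ' L
      left-L j 1≤j bound with compare-with k j
      ... | inj₁ j<k = begin
        leftDescent L j                       ≡⟨ sym (proj₂ (proj₂ (pos-filter-order (small k) {suc j} {j} (≤ᵇ-intro j<k) (≤ᵇ-intro (<⇒≤ j<k)) L))) ⟩
        leftDescent (filterᵇ (small k) L) j   ≡⟨ cong (λ z → leftDescent z j) small-L ⟩
        leftDescent (countdown k) j           ≡⟨ leftDescent-countdown k j 1≤j j<k ⟩
        true                                  ≡⟨ cong not (sym (not-descent-below j j<k)) ⟩
        not (j ∈ᵇ properPartialSums (dual λ')) ∎
        where open ≡-Reasoning
      ... | inj₂ (inj₁ refl) =
        let (rest , L≡) = reattach-countdown-head k Cs k≥1 length-Cs
            k+1∈ = subst (suc k ∈_) L≡ (permList-complete perm-L (suc k) (s≤s z≤n) bound) in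
        trans (cong (λ z → leftDescent z k) L≡)
          (trans (no-leftDescent-at-head k rest k+1∈) (cong not (sym (descent-at bound))))
      ... | inj₂ (inj₂ (i , refl)) = begin
        leftDescent L (k + suc i)             ≡⟨ cong (leftDescent L) (+-comm k (suc i)) ⟩
        leftDescent L (suc i + k)             ≡⟨ sym (leftDescent-peel k L (suc i) (s≤s z≤n)) ⟩
        leftDescent (peel k L) (suc i)        ≡⟨ cong (λ z → leftDescent z (suc i)) peel-L ⟩
        leftDescent L' (suc i)                ≡⟨ proj₁ (proj₂ g') (suc i) (s≤s z≤n) bound' ⟩
        not (suc i ∈ᵇ properPartialSums (dual (cut 1 λ'))) ≡⟨ cong not (sym (descent-above i)) ⟩
        not ((k + suc i) ∈ᵇ properPartialSums (dual λ')) ∎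
        where
        open ≡-Reasoning
        bound' : suc (suc i) ≤ n'
        bound' = subst (_≤ n') (m+n∸m≡n k (suc (suc i))) (∸-monoˡ-≤ k (subst (_≤ n) (sym (+-suc k (suc i))) bound))

      right-L : RightDescentsIn μ L
      right-L = blocks⇒rightDescents (Reattach.blocks-reattach k μ (countdown k) Cs (partition-positive pμ) blocks fits)

    unpeel-admissible : Admissible n λ' μ (unpeel k s L')
    unpeel-admissible = subst (Admissible n λ' μ) (sym unpeel≡L) (perm-L , left-L , right-L)

    peel-unpeel : peel k (unpeel k s L') ≡ L'
    peel-unpeel = trans (cong (peel k) unpeel≡L) peel-L

  peel-bijection : 𝒟 n (𝕁 λ') (Jpart μ) ⤖ 𝒟 n' (𝕁 (cut 1 λ')) (Jpart (cut 1 μ))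
  peel-bijection = mk⤖ {to = to} (injective , surjective)
    where
    word : ∀ {m J K} → 𝒟 m J K → List ℕ
    word d = values (proj₁ d)

    to : 𝒟 n (𝕁 λ') (Jpart μ) → 𝒟 n' (𝕁 (cut 1 λ')) (Jpart (cut 1 μ))
    to d = proj₁ (admissible⇒𝒟 n' (cut 1 λ') (cut 1 μ) (peel k (word d)) (Forward.peel-admissible (word d) (𝒟⇒admissible n λ' μ d)))

    word-to : ∀ d → word (to d) ≡ peel k (word d)
    word-to d = proj₂ (admissible⇒𝒟 n' (cut 1 λ') (cut 1 μ) (peel k (word d)) (Forward.peel-admissible (word d) (𝒟⇒admissible n λ' μ d)))

    unpeel-to : ∀ d → unpeel k s (word (to d)) ≡ word d
    unpeel-to d = trans (cong (unpeel k s) (word-to d)) (Forward.unpeel-peel (word d) (𝒟⇒admissible n λ' μ d))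

    injective : ∀ {a b} → to a ≡ to b → a ≡ b
    injective {a} {b} e = 𝒟-≡ (values-injective (trans (sym (unpeel-to a)) (trans (cong (unpeel k s ∘ word) e) (unpeel-to b))))

    surjective : ∀ y → ∃ λ x → ∀ {z} → z ≡ x → to z ≡ y
    surjective y = x , λ { refl → 𝒟-≡ (values-injective (trans (word-to x) (trans (cong (peel k) x-word) peel-unpeel))) }
      where
      open Backward (word y) (𝒟⇒admissible n' (cut 1 λ') (cut 1 μ) y)
      preimage = admissible⇒𝒟 n λ' μ _ unpeel-admissible
      x = proj₁ preimage
      x-word : word x ≡ unpeel k s (word y)
      x-word = proj₂ preimage

𝒟-cong : ∀ {m m' λ₁ λ₂ μ₁ μ₂} → m ≡ m' → λ₁ ≡ λ₂ → μ₁ ≡ μ₂ →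
  𝒟 m (𝕁 λ₁) (Jpart μ₁) ⤖ 𝒟 m' (𝕁 λ₂) (Jpart μ₂)
𝒟-cong refl refl refl = ⤖-id _

peel-columns : ∀ n k λ' μ → IsPartition n λ' → length λ' ≡ suc k → IsPartition n μ → length μ ≡ suc k →
  ∀ t → t ≤ part λ' (suc k) → t ≤ part μ (suc k) →
  𝒟 n (𝕁 λ') (Jpart μ) ⤖ 𝒟 (n ∸ suc k * t) (𝕁 (cut t λ')) (Jpart (cut t μ))
peel-columns n k λ' μ pλ lλ pμ lμ zero _ _ =
  𝒟-cong (sym (cong (n ∸_) (*-zeroʳ k))) (sym (cut-zero λ' (partition-positive pλ))) (sym (cut-zero μ (partition-positive pμ)))
peel-columns n k λ' μ pλ lλ pμ lμ (suc t) t<λₖ t<μₖ =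
  𝒟-cong columns (cut-suc t λ') (cut-suc t μ)
    ⤖-∘ (PeelStep.peel-bijection (n ∸ suc k * t) (suc k) (cut t λ') (cut t μ) (proj₁ λ[t]) (proj₂ λ[t]) (proj₁ μ[t]) (proj₂ μ[t]) (s≤s z≤n)
    ⤖-∘ peel-columns n k λ' μ pλ lλ pμ lμ t (<⇒≤ t<λₖ) (<⇒≤ t<μₖ))
  where
  λ[t] = cut-partition n (suc k) t λ' pλ lλ (λ y∈ → <-≤-trans t<λₖ (last-part-≤ λ' k (proj₁ pλ) lλ y∈))
  μ[t] = cut-partition n (suc k) t μ pμ lμ (λ y∈ → <-≤-trans t<μₖ (last-part-≤ μ k (proj₁ pμ) lμ y∈))
  columns : n ∸ suc k * t ∸ suc k ≡ n ∸ suc k * suc t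
  columns = trans (∸-+-assoc n (suc k * t) (suc k)) (cong (n ∸_) (trans (+-comm (suc k * t) (suc k)) (sym (*-suc (suc k) t))))

-- Part (1): if μ_k < λ_k there is no such word.  Either μ has fewer than k
-- rows, or removing μ_k columns gives a μ[μ_k] with fewer rows than λ[μ_k].
no-words : ∀ n k λ' μ → IsPartition n λ' → length λ' ≡ suc k → IsPartition n μ → length μ ≤ suc k →
  part μ (suc k) < part λ' (suc k) → ¬ 𝒟 n (𝕁 λ') (Jpart μ)
no-words n k λ' μ pλ lλ pμ lμ μₖ<λₖ d with m≤n⇒m<n∨m≡n lμ
... | inj₁ fewer = Rows.no-admissible-with-fewer-parts n (suc k) λ' pλ lλ (s≤s z≤n) μ _ (proj₂ (proj₂ pμ)) fewer
  (𝒟⇒admissible n λ' μ d)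
... | inj₂ full =
  Rows.no-admissible-with-fewer-parts n' (suc k) (cut b λ') (proj₁ λ[b]) (proj₂ λ[b]) (s≤s z≤n) (cut b μ) _ sum-μ[b] fewer
    (𝒟⇒admissible n' (cut b λ') (cut b μ) (Bijection.to (peel-columns n k λ' μ pλ lλ pμ full b (<⇒≤ μₖ<λₖ) ≤-refl) d))
  where
  b = part μ (suc k)
  n' = n ∸ suc k * b
  λ[b] = cut-partition n (suc k) b λ' pλ lλ (λ y∈ → <-≤-trans μₖ<λₖ (last-part-≤ λ' k (proj₁ pλ) lλ y∈))
  sum-μ[b] : sum (cut b μ) ≡ n'
  sum-μ[b] = trans (sum-cut b μ (last-part-≤ μ k (proj₁ pμ) full)) (cong₂ _∸_ (proj₂ (proj₂ pμ)) (cong (_* b) full))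
  fewer : length (cut b μ) < suc k
  fewer = subst (length (cut b μ) <_) full (cut-shortens b μ (last-part-∈ μ k full))

-- Part (2) needs μ to have all k rows: otherwise μ_k = 0 < 1 ≤ λ_k.
full-rows : ∀ n k λ' μ → IsPartition n λ' → length λ' ≡ suc k → length μ ≤ suc k →
  part λ' (suc k) ≤ part μ (suc k) → length μ ≡ suc k
full-rows n k λ' μ pλ lλ lμ λₖ≤μₖ with m≤n⇒m<n∨m≡n lμ
... | inj₂ full = full
... | inj₁ fewer = ⊥-elim (1+n≰n (≤-trans (partition-positive pλ (last-part-∈ λ' k lλ))
  (≤-trans λₖ≤μₖ (≤-reflexive (part-beyond μ (suc k) fewer)))))

proposition4p1 : (n k : ℕ) (λ' μ : List ℕ) →
    IsPartition n λ' → length λ' ≡ k →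
    IsPartition n μ → length μ ≤ k →
    (part μ k < part λ' k →
       ¬ 𝒟 n (𝕁 λ') (Jpart μ) × A n λ' μ ≡ 0)
    ×
    (part λ' k ≤ part μ k →
       (ℓ : ℕ) → ℓ ≤ part λ' k →
         (𝒟 n (𝕁 λ') (Jpart μ) ⤖ 𝒟 (n ∸ k * ℓ) (𝕁 (cut ℓ λ')) (Jpart (cut ℓ μ)))
         × A n λ' μ ≡ A (n ∸ k * ℓ) (cut ℓ λ') (cut ℓ μ))
proposition4p1 n zero [] [] (_ , _ , refl) refl _ z≤n = (λ ()) , λ { _ zero z≤n → ⤖-id _ , refl }
proposition4p1 n (suc k) λ' μ pλ lλ pμ lμ = vanishing , stable
  where
  vanishing : part μ (suc k) < part λ' (suc k) → ¬ 𝒟 n (𝕁 λ') (Jpart μ) × A n λ' μ ≡ 0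
  vanishing μₖ<λₖ = let none = no-words n k λ' μ pλ lλ pμ lμ μₖ<λₖ in none , card-empty n _ _ none
  stable : part λ' (suc k) ≤ part μ (suc k) → (ℓ : ℕ) → ℓ ≤ part λ' (suc k) →
    (𝒟 n (𝕁 λ') (Jpart μ) ⤖ 𝒟 (n ∸ suc k * ℓ) (𝕁 (cut ℓ λ')) (Jpart (cut ℓ μ)))
    × A n λ' μ ≡ A (n ∸ suc k * ℓ) (cut ℓ λ') (cut ℓ μ)
  stable λₖ≤μₖ ℓ ℓ≤λₖ =
    let bij = peel-columns n k λ' μ pλ lλ pμ (full-rows n k λ' μ pλ lλ lμ λₖ≤μₖ) ℓ ℓ≤λₖ (≤-trans ℓ≤λₖ λₖ≤μₖ)
    in bij , card-⤖ bij
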